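{- Let $N\ge3$ be odd and let $A$ be a compressible arrangement in the $N\times N$ square whose boundary pattern has exactly one empty corner (all other boundary cells filled), and which is an acyclic polyomino. Then $A$ is efficiently structured if and only if $C(A)$ is efficiently structured.
   Context: A polyomino is a finite union of closed unit squares (tiles) of the square lattice, any two of which intersect in nothing, a vertex, or an entire common edge, with connected interior; holes are bounded components of the complement, the area of a hole is its number of lattice cells; acyclic means the dual graph (tiles, adjacency across edges) is a tree; the outer perimeter $p_o$ is the number of boundary unit edges not bounding a hole. A polyomino with $n$ tiles and $h$ holes is efficiently structured if it is acyclic, all holes have area one, and $p_o=2\lceil2\sqrt{n+h}\,\rceil$. Arrangements and compression: in a $K\times K$ square with cells $(r,c)$, row 1 on top, the boundary layer is the cells with $r$ or $c$ in $\{1,K\}$. For odd $N$, $P_N$ requires every interior cell $(r,c)$ with $r+c$ odd to be filled and every interior cell with $r,c$ both even to be empty; $U_N=\{(2i+1,2j+1):1\le i,j\le (N-3)/2\}$. An arrangement of filled/empty cells in the $N\times N$ square is compressible if all non-corner boundary cells are filled, at least one corner is empty, and it agrees with $P_N$ off $U_N$. Its compression $C(A)$ is the arrangement in the $\frac{N+1}2\times\frac{N+1}2$ square with the same boundary pattern (non-corner boundary filled, corners filled as in $A$) and interior cell $(i+1,j+1)$ filled iff $(2i+1,2j+1)$ is filled in $A$. -}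

module Defs where

open import Data.Nat using (ℕ; zero; suc; _+_; _*_; _∸_; _≤_; _<_; _≡ᵇ_; _%_)
open import Data.Bool using (Bool; true; false; _∧_; _∨_; not; if_then_else_)
open import Data.Fin using (Fin; toℕ)
open import Data.Maybe using (Maybe; just; nothing)
import Data.Maybe as Maybe
open import Data.Product using (Σ; ∃; ∃-syntax; _×_; _,_)
open import Data.Sum using (_⊎_)
open import Data.List using (List; []; _∷_; _++_; [_]; length)
open import Data.List.Relation.Unary.All using (All)
open import Data.List.Relation.Unary.Linked using (Linked)
open import Data.List.Relation.Unary.Unique.Propositional using (Unique)
open import Data.List.Membership.Propositional using (_∈_)
open import Relation.Nullary using (¬_)
open import Relation.Binary.PropositionalEquality using (_≡_)

-- Arrangements in a K × K square.  Fin indices are 0-based; the paper's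
-- cell (r , c) (1-based, row 1 on top) is  A (r-1) (c-1).

Arr : ℕ → Set
Arr K = Fin K → Fin K → Bool

toFin? : (K i : ℕ) → Maybe (Fin K)
toFin? zero    _       = nothing
toFin? (suc K) zero    = just Fin.zero
toFin? (suc K) (suc i) = Maybe.map Fin.suc (toFin? K i)

-- value of the paper's cell (r , c), 1-based; cells outside the square
-- (r or c = 0 or > K) are empty (false)
at : ∀ {K} → Arr K → ℕ → ℕ → Bool
at A zero    _       = false
at A (suc r) zero    = false
at {K} A (suc r) (suc c) with toFin? K r | toFin? K c
... | just i  | just j  = A i j
... | _       | _       = false

-- Lattice cells of the plane near the square: pairs (r , c) of naturals.
-- The padded box  0 ≤ r , c ≤ K+1  contains the square and the ring of
-- cells around it (all empty).

Cell : Set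
Cell = ℕ × ℕ

data Adj : Cell → Cell → Set where
  down  : ∀ {r c} → Adj (r , c) (suc r , c)
  up    : ∀ {r c} → Adj (suc r , c) (r , c)
  right : ∀ {r c} → Adj (r , c) (r , suc c)
  left  : ∀ {r c} → Adj (r , suc c) (r , c)

data Path (P : Cell → Set) : Cell → Cell → Set where
  here : ∀ {x} → P x → Path P x x
  step : ∀ {x y z} → P x → Adj x y → Path P y z → Path P x z

module _ {K : ℕ} (A : Arr K) where

  Filled : Cell → Set
  Filled (r , c) = at A r c ≡ true

  EmptyBox : Cell → Set
  EmptyBox (r , c) = r ≤ suc K × c ≤ suc K × at A r c ≡ false

  -- polyomino: nonempty and the tiles are edge-connected
  -- (equivalently, the union of the tiles has connected interior)
  Polyomino : Set
  Polyomino = (∃[ x ] Filled x) × (∀ x y → Filled x → Filled y → Path Filled x y)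

  DualCycle : Set
  DualCycle = Σ Cell λ x → Σ (List Cell) λ xs →
                2 ≤ length xs × Unique (x ∷ xs) × All Filled (x ∷ xs)
                × Linked Adj (x ∷ xs ++ [ x ])

  Acyclic : Set
  Acyclic = Polyomino × ¬ DualCycle

  -- cells of the unbounded component of the complement
  -- (the ring cell (0 , 0) lies in it)
  Outer : Cell → Set
  Outer x = Path EmptyBox (0 , 0) x

  HoleCell : Cell → Set
  HoleCell x = EmptyBox x × ¬ Outer x

  HolesUnit : Set
  HolesUnit = ∀ x y → HoleCell x → Path EmptyBox x y → x ≡ y

  _≤lex_ : Cell → Cell → Set
  (r , c) ≤lex (r' , c') = r < r' ⊎ (r ≡ r' × c ≤ c')

  -- each hole is counted via its lexicographically least cell
  HoleRep : Cell → Set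
  HoleRep x = HoleCell x × (∀ y → Path EmptyBox x y → x ≤lex y)

  -- unit boundary edges not bounding a hole: (tile , outer empty neighbour)
  OuterEdge : Cell × Cell → Set
  OuterEdge (x , y) = Filled x × Adj x y × Outer y

Card : {X : Set} → (X → Set) → ℕ → Set
Card {X} P m = Σ (List X) λ L → Unique L × (∀ x → x ∈ L → P x)
                 × (∀ x → P x → x ∈ L) × length L ≡ m

-- k = ⌈ 2 √ m ⌉ : the least natural k with k² ≥ 4m
IsCeilTwoSqrt : ℕ → ℕ → Set
IsCeilTwoSqrt m k = 4 * m ≤ k * k × (∀ j → 4 * m ≤ j * j → k ≤ j)

EffStruct : ∀ {K} → Arr K → Set
EffStruct A = Acyclic A × HolesUnit A ×
  (∃[ n ] ∃[ h ] ∃[ p ] ∃[ k ]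
     Card (Filled A) n × Card (HoleRep A) h × Card (OuterEdge A) p
     × IsCeilTwoSqrt (n + h) k × p ≡ 2 * k)

isB : ℕ → ℕ → Bool
isB K r = (r ≡ᵇ 1) ∨ (r ≡ᵇ K)

inSq : ℕ → ℕ → ℕ → Bool
inSq K r c = not (r ≡ᵇ 0) ∧ not (c ≡ᵇ 0) ∧ (r Data.Nat.≤ᵇ K) ∧ (c Data.Nat.≤ᵇ K)

corner : ℕ → ℕ → ℕ → Bool
corner K r c = isB K r ∧ isB K c

nonCornerBoundary : ℕ → ℕ → ℕ → Bool
nonCornerBoundary K r c = (isB K r ∨ isB K c) ∧ not (corner K r c)

interior : ℕ → ℕ → ℕ → Bool
interior K r c = inSq K r c ∧ not (isB K r) ∧ not (isB K c)

Compressible : (N : ℕ) → Arr N → Set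
Compressible N A =
  (∀ r c → inSq N r c ≡ true → nonCornerBoundary N r c ≡ true → at A r c ≡ true)
  × (∃[ r ] ∃[ c ] (corner N r c ≡ true × at A r c ≡ false))
  -- agreement with P_N off U_N
  × (∀ r c → interior N r c ≡ true → (r + c) % 2 ≡ 1 → at A r c ≡ true)
  × (∀ r c → interior N r c ≡ true → r % 2 ≡ 0 → c % 2 ≡ 0 → at A r c ≡ false)

ExactlyOneEmptyCorner : (N : ℕ) → Arr N → Set
ExactlyOneEmptyCorner N A =
  ∃[ r ] ∃[ c ] (corner N r c ≡ true × at A r c ≡ false ×
     (∀ r' c' → corner N r' c' ≡ true → at A r' c' ≡ false → r' ≡ r × c' ≡ c))

-- compression, N = 2m+1, M = (N+1)/2 = m+1.  The M-square cell (r , c),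
-- r = i+1, c = j+1: non-corner boundary cells filled; otherwise (corners and
-- interior) copy A at (2r-1 , 2c-1) = (2i+1 , 2j+1); for corners this is the
-- corresponding corner of A, for interior cells (i'+1 , j'+1) it is (2i'+1 , 2j'+1).
compress : (m : ℕ) → Arr (suc (2 * m)) → Arr (suc m)
compress m A i j =
  if nonCornerBoundary (suc m) (suc (toℕ i)) (suc (toℕ j))
  then true
  else at A (suc (2 * toℕ i)) (suc (2 * toℕ j))

module Submission where

-- Proof idea.  Under the hypotheses both sides of the equivalence hold, and
-- they hold for one common reason, isolated in the criterion of the module
-- SingleEmptyCorner:
--
--   Let B be an acyclic arrangement in a K × K square (K ≥ 2) with an empty
--   corner κ such that every other empty cell of the square has only filled
--   neighbours.  Then the cells of the outer complementary component are
--   the cells outside the square together with κ, every other empty cell is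
--   a hole of area one, n + h = K² − 1 (so ⌈2√(n+h)⌉ = 2K), and the outer
--   perimeter is 4K = 2 · 2K.  Hence B is efficiently structured.
--
-- For A the hypothesis of the criterion is read off from compressibility
-- (every interior cell with odd coordinate sum is a tile).  For C = C(A) the
-- cell (a+1 , b+1) of C is the cell (2a+1 , 2b+1) of A; two adjacent empty
-- cells of C would make the tile of A between them an isolated tile, against
-- connectivity of A.  Paths of A between odd–odd tiles project to paths of
-- C, so C is a polyomino, and a cycle of C lifts to a cycle of A (insert the
-- midpoint tiles), so C is acyclic.

open import Defs
open import Data.Nat
open import Data.Nat.Properties
open import Data.Nat.Tactic.RingSolver using (solve-∀)
open import Data.Bool using (Bool; true; false; not; _∧_; _∨_; T; if_then_else_)
import Data.Bool.Properties as Boolₚ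
open import Data.Fin using (Fin; toℕ) renaming (zero to fzero; suc to fsuc)
open import Data.Maybe using (just; nothing)
open import Data.Product using (Σ; ∃-syntax; _×_; _,_; proj₁; proj₂; uncurry)
open import Data.Product.Properties using (≡-dec)
open import Data.Sum using (_⊎_; inj₁; inj₂)
import Data.Sum as Sum
open import Data.Empty using (⊥-elim)
open import Data.List using (List; []; _∷_; _++_; [_]; length; filter; map; applyUpTo; cartesianProduct)
open import Data.List.Properties using (length-map; length-++; length-applyUpTo)
open import Data.List.Relation.Unary.All as All using (All; []; _∷_)
import Data.List.Relation.Unary.All.Properties as Allₚ
open import Data.List.Relation.Unary.AllPairs using ([]; _∷_)
open import Data.List.Relation.Unary.Any using (here; there)
open import Data.List.Relation.Unary.Linked using (Linked; []; [-]; _∷_)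
open import Data.List.Relation.Unary.Unique.Propositional using (Unique)
import Data.List.Relation.Unary.Unique.Propositional.Properties as Uniqueₚ
open import Data.List.Membership.Propositional using (_∈_; _∉_)
open import Data.List.Membership.Propositional.Properties
  using (∈-applyUpTo⁺; ∈-applyUpTo⁻; ∈-cartesianProduct⁺; ∈-cartesianProduct⁻; ∈-filter⁺; ∈-filter⁻;
         ∈-++⁺ˡ; ∈-++⁺ʳ; ∈-++⁻; ∈-map⁺; ∈-map⁻)
open import Relation.Nullary using (¬_; Dec; yes; no; ¬?)
open import Relation.Nullary.Decidable using (_×-dec_)
open import Relation.Unary using (Decidable)
open import Relation.Binary.PropositionalEquality hiding ([_])
open import Function.Bundles using (_⇔_; mk⇔; Equivalence)

true≢false : true ≢ false
true≢false ()

tile≢empty : ∀ {b} → b ≡ true → b ≢ false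
tile≢empty t f = true≢false (trans (sym t) f)

toFin?-just : ∀ K i {j} → toFin? K i ≡ just j → toℕ j ≡ i × i < K
toFin?-just (suc K) zero refl = refl , s≤s z≤n
toFin?-just (suc K) (suc i) eq with toFin? K i in e
toFin?-just (suc K) (suc i) refl | just j with toFin?-just K i e
... | j≡i , i<K = cong suc j≡i , s≤s i<K

toFin?-lt : ∀ K i → i < K → Σ (Fin K) λ j → toFin? K i ≡ just j
toFin?-lt (suc K) zero _ = fzero , refl
toFin?-lt (suc K) (suc i) (s≤s i<K) with toFin?-lt K i i<K
... | j , e rewrite e = fsuc j , refl

atc : ∀ {K} → Arr K → Cell → Bool
atc A (r , c) = at A r c

InSq : ℕ → Cell → Set
InSq K (r , c) = 1 ≤ r × r ≤ K × 1 ≤ c × c ≤ K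

inSq? : ∀ K x → Dec (InSq K x)
inSq? K (r , c) = (1 ≤? r) ×-dec (r ≤? K) ×-dec (1 ≤? c) ×-dec (c ≤? K)

filled⇒inSq : ∀ {K} (A : Arr K) r c → at A r c ≡ true → InSq K (r , c)
filled⇒inSq A zero c ()
filled⇒inSq A (suc r) zero ()
filled⇒inSq {K} A (suc r) (suc c) _ with toFin? K r in e₁ | toFin? K c in e₂
... | just i | just j =
  s≤s z≤n , proj₂ (toFin?-just K r e₁) , s≤s z≤n , proj₂ (toFin?-just K c e₂)
filled⇒inSq {K} A (suc r) (suc c) () | just i | nothing
filled⇒inSq {K} A (suc r) (suc c) () | nothing | _

outside⇒empty : ∀ {K} (A : Arr K) x → ¬ InSq K x → atc A x ≡ false
outside⇒empty A (r , c) x∉ with at A r c in e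
... | true = ⊥-elim (x∉ (filled⇒inSq A r c e))
... | false = refl

adj-sym : ∀ {x y} → Adj x y → Adj y x
adj-sym down = up
adj-sym up = down
adj-sym right = left
adj-sym left = right

adj-≢ : ∀ {x y} → Adj x y → x ≢ y
adj-≢ down e = 1+n≢n (sym (cong proj₁ e))
adj-≢ up e = 1+n≢n (cong proj₁ e)
adj-≢ right e = 1+n≢n (sym (cong proj₂ e))
adj-≢ left e = 1+n≢n (cong proj₂ e)

path-head : ∀ {P x y} → Path P x y → P x
path-head (here p) = p
path-head (step p _ _) = p

path-snoc : ∀ {P x y z} → Path P x y → Adj y z → P z → Path P x z
path-snoc (here p) a pz = step p a (here pz)
path-snoc (step p a rest) a' pz = step p a (path-snoc rest a' pz)

_≟c_ : (x y : Cell) → Dec (x ≡ y)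
_≟c_ = ≡-dec _≟_ _≟_

module _ {X : Set} where

  count-split : ∀ {P : X → Set} (P? : Decidable P) xs →
    length (filter P? xs) + length (filter (λ x → ¬? (P? x)) xs) ≡ length xs
  count-split P? [] = refl
  count-split P? (x ∷ xs) with P? x
  ... | yes _ = cong suc (count-split P? xs)
  ... | no _ = trans (+-suc _ _) (cong suc (count-split P? xs))

  count-cong : ∀ {P Q : X → Set} (P? : Decidable P) (Q? : Decidable Q) xs →
    (∀ x → x ∈ xs → (P x → Q x) × (Q x → P x)) →
    length (filter P? xs) ≡ length (filter Q? xs)
  count-cong P? Q? [] h = refl
  count-cong P? Q? (x ∷ xs) h with P? x | Q? x
  ... | yes _ | yes _ = cong suc (count-cong P? Q? xs (λ y m → h y (there m)))
  ... | no _ | no _ = count-cong P? Q? xs (λ y m → h y (there m))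
  ... | yes p | no q = ⊥-elim (q (proj₁ (h x (here refl)) p))
  ... | no p | yes q = ⊥-elim (p (proj₂ (h x (here refl)) q))

  count-zero : ∀ {P : X → Set} (P? : Decidable P) xs →
    (∀ x → x ∈ xs → ¬ P x) → length (filter P? xs) ≡ 0
  count-zero P? [] h = refl
  count-zero P? (x ∷ xs) h with P? x
  ... | yes p = ⊥-elim (h x (here refl) p)
  ... | no _ = count-zero P? xs (λ y m → h y (there m))

  count-one : ∀ {P : X → Set} (P? : Decidable P) xs c → Unique xs → c ∈ xs →
    (∀ x → x ∈ xs → (P x → x ≡ c) × (x ≡ c → P x)) → length (filter P? xs) ≡ 1
  count-one P? (x ∷ xs) c (x∉xs ∷ _) (here refl) h with P? x
  ... | yes _ = cong suc (count-zero P? xs λ y m py →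
                  All.lookup x∉xs m (sym (proj₁ (h y (there m)) py)))
  ... | no ¬p = ⊥-elim (¬p (proj₂ (h x (here refl)) refl))
  count-one P? (x ∷ xs) c (x∉xs ∷ u) (there c∈xs) h with P? x
  ... | yes p = ⊥-elim (All.lookup x∉xs c∈xs (proj₁ (h x (here refl)) p))
  ... | no _ = count-one P? xs c u c∈xs (λ y m → h y (there m))

  count-++ : ∀ {P : X → Set} (P? : Decidable P) xs ys →
    length (filter P? (xs ++ ys)) ≡ length (filter P? xs) + length (filter P? ys)
  count-++ P? [] ys = refl
  count-++ P? (x ∷ xs) ys with P? x
  ... | yes _ = cong suc (count-++ P? xs ys)
  ... | no _ = count-++ P? xs ys

  count-partition₃ : ∀ {P Q R : X → Set} (P? : Decidable P) (Q? : Decidable Q) (R? : Decidable R) xs →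
    (∀ x → P x ⊎ Q x ⊎ R x) → (∀ x → P x → ¬ Q x) → (∀ x → P x → ¬ R x) → (∀ x → Q x → ¬ R x) →
    length (filter P? xs) + length (filter Q? xs) + length (filter R? xs) ≡ length xs
  count-partition₃ P? Q? R? [] cover _ _ _ = refl
  count-partition₃ P? Q? R? (x ∷ xs) cover PQ PR QR
    with P? x | Q? x | R? x | count-partition₃ P? Q? R? xs cover PQ PR QR
  ... | yes p | yes q | _ | _ = ⊥-elim (PQ x p q)
  ... | yes p | no _ | yes r | _ = ⊥-elim (PR x p r)
  ... | yes _ | no _ | no _ | ih = cong suc ih
  ... | no _ | yes q | yes r | _ = ⊥-elim (QR x q r)
  ... | no _ | yes _ | no _ | ih = trans (cong (_+ length (filter R? xs)) (+-suc _ _)) (cong suc ih)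
  ... | no _ | no _ | yes _ | ih = trans (+-suc _ _) (cong suc ih)
  ... | no ¬p | no ¬q | no ¬r | _ = ⊥-elim (Sum.[ ¬p , Sum.[ ¬q , ¬r ] ] (cover x))

count-map : ∀ {X Y : Set} {P : Y → Set} (P? : Decidable P) (f : X → Y) xs →
  length (filter P? (map f xs)) ≡ length (filter (λ x → P? (f x)) xs)
count-map P? f [] = refl
count-map P? f (x ∷ xs) with P? (f x)
... | yes _ = cong suc (count-map P? f xs)
... | no _ = count-map P? f xs

ceilTwoSqrt : ∀ K S → 2 ≤ K → S + 1 ≡ K * K → IsCeilTwoSqrt S (2 * K)
ceilTwoSqrt K@(suc (suc t)) S (s≤s (s≤s z≤n)) S+1≡K² = upper , least
  where
  open ≤-Reasoning
  4S+4≡[2K]² : 4 * S + 4 ≡ 2 * K * (2 * K)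
  4S+4≡[2K]² = begin-equality
    4 * S + 4     ≡⟨ sym (*-distribˡ-+ 4 S 1) ⟩
    4 * (S + 1)   ≡⟨ cong (4 *_) S+1≡K² ⟩
    4 * (K * K)   ≡⟨ four-squares K ⟩
    2 * K * (2 * K) ∎
    where
    four-squares : ∀ n → 4 * (n * n) ≡ 2 * n * (2 * n)
    four-squares = solve-∀

  -- (2K)² = (2K − 1)² + (4K − 5) + 4, written with K = t + 2
  [2K]²-split : ∀ t → 2 * suc (suc t) * (2 * suc (suc t)) ≡ (2 * t + 3) * (2 * t + 3) + (4 * t + 3) + 4
  [2K]²-split = solve-∀

  upper : 4 * S ≤ 2 * K * (2 * K)
  upper = ≤-trans (m≤m+n (4 * S) 4) (≤-reflexive 4S+4≡[2K]²)

  least : ∀ j → 4 * S ≤ j * j → 2 * K ≤ j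
  least j 4S≤j² with 2 * K ≤? j
  ... | yes 2K≤j = 2K≤j
  ... | no 2K≰j = ⊥-elim (<-irrefl refl (begin-strict
      4 * S                                    ≤⟨ 4S≤j² ⟩
      j * j                                    ≤⟨ *-mono-≤ j≤2K-1 j≤2K-1 ⟩
      (2 * t + 3) * (2 * t + 3)                <⟨ m<m+n _ (<-≤-trans (s≤s z≤n) (m≤n+m 3 (4 * t))) ⟩
      (2 * t + 3) * (2 * t + 3) + (4 * t + 3)  ≡⟨ +-cancelʳ-≡ 4 _ _ (trans (sym ([2K]²-split t)) (sym 4S+4≡[2K]²)) ⟩
      4 * S                                    ∎))
    where
    2K≡1+[2t+3] : ∀ t → 2 * suc (suc t) ≡ suc (2 * t + 3)
    2K≡1+[2t+3] = solve-∀
    j≤2K-1 : j ≤ 2 * t + 3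
    j≤2K-1 = ≤-pred (subst (suc j ≤_) (2K≡1+[2t+3] t) (≰⇒> 2K≰j))

T⇒≡true : ∀ {b} → T b → b ≡ true
T⇒≡true = Equivalence.to Boolₚ.T-≡

≡true⇒T : ∀ {b} → b ≡ true → T b
≡true⇒T = Equivalence.from Boolₚ.T-≡

≢true⇒≡false : ∀ {b} → b ≢ true → b ≡ false
≢true⇒≡false = Boolₚ.¬-not

≡ᵇ-false : ∀ m n → m ≢ n → (m ≡ᵇ n) ≡ false
≡ᵇ-false m n m≢n = ≢true⇒≡false (λ t → m≢n (≡ᵇ⇒≡ m n (≡true⇒T t)))

isB-intro : ∀ K r → r ≡ 1 ⊎ r ≡ K → isB K r ≡ true
isB-intro K r (inj₁ refl) = refl
isB-intro K r (inj₂ refl) rewrite T⇒≡true (≡⇒≡ᵇ r r refl) = Boolₚ.∨-zeroʳ (r ≡ᵇ 1)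

isB-false : ∀ K r → r ≢ 1 → r ≢ K → isB K r ≡ false
isB-false K r r≢1 r≢K rewrite ≡ᵇ-false r 1 r≢1 | ≡ᵇ-false r K r≢K = refl

isB-elim : ∀ K r → isB K r ≡ true → r ≡ 1 ⊎ r ≡ K
isB-elim K r e with r ≡ᵇ 1 in e₁
... | true = inj₁ (≡ᵇ⇒≡ r 1 (≡true⇒T e₁))
... | false = inj₂ (≡ᵇ⇒≡ r K (≡true⇒T e))

isB-false⇒≢1 : ∀ K r → isB K r ≡ false → r ≢ 1
isB-false⇒≢1 K r e r≡1 = tile≢empty (isB-intro K r (inj₁ r≡1)) e

isB-false⇒≢K : ∀ K r → isB K r ≡ false → r ≢ K
isB-false⇒≢K K r e r≡K = tile≢empty (isB-intro K r (inj₂ r≡K)) e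

inSq-intro : ∀ K r c → InSq K (r , c) → inSq K r c ≡ true
inSq-intro K (suc r) (suc c) (_ , r≤K , _ , c≤K)
  rewrite T⇒≡true (≤⇒≤ᵇ r≤K) | T⇒≡true (≤⇒≤ᵇ c≤K) = refl

nonCornerBoundary-row : ∀ K r c → isB K r ≡ true → isB K c ≡ false → nonCornerBoundary K r c ≡ true
nonCornerBoundary-row K r c e₁ e₂ rewrite e₁ | e₂ = refl

nonCornerBoundary-col : ∀ K r c → isB K r ≡ false → isB K c ≡ true → nonCornerBoundary K r c ≡ true
nonCornerBoundary-col K r c e₁ e₂ rewrite e₁ | e₂ = refl

interior-intro : ∀ K r c → inSq K r c ≡ true → isB K r ≡ false → isB K c ≡ false → interior K r c ≡ true
interior-intro K r c e₀ e₁ e₂ rewrite e₀ | e₁ | e₂ = refl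

corner-intro : ∀ K r c → isB K r ≡ true → isB K c ≡ true → corner K r c ≡ true
corner-intro K r c e₁ e₂ rewrite e₁ | e₂ = refl

corner-elim : ∀ K r c → corner K r c ≡ true → isB K r ≡ true × isB K c ≡ true
corner-elim K r c e with isB K r | isB K c
... | true | true = refl , refl
... | true | false = ⊥-elim (true≢false (sym e))
... | false | _ = ⊥-elim (true≢false (sym e))

mod2-cases : ∀ n → n % 2 ≡ 0 ⊎ n % 2 ≡ 1
mod2-cases zero = inj₁ refl
mod2-cases (suc zero) = inj₂ refl
mod2-cases (suc (suc n)) = mod2-cases n

even⇒suc-odd : ∀ n → n % 2 ≡ 0 → suc n % 2 ≡ 1
even⇒suc-odd zero _ = refl
even⇒suc-odd (suc zero) ()
even⇒suc-odd (suc (suc n)) e = even⇒suc-odd n e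

odd⇒suc-even : ∀ n → n % 2 ≡ 1 → suc n % 2 ≡ 0
odd⇒suc-even zero ()
odd⇒suc-even (suc zero) _ = refl
odd⇒suc-even (suc (suc n)) e = odd⇒suc-even n e

suc-even⇒odd : ∀ n → suc n % 2 ≡ 0 → n % 2 ≡ 1
suc-even⇒odd zero ()
suc-even⇒odd (suc zero) _ = refl
suc-even⇒odd (suc (suc n)) e = suc-even⇒odd n e

suc-odd⇒even : ∀ n → suc n % 2 ≡ 1 → n % 2 ≡ 0
suc-odd⇒even zero _ = refl
suc-odd⇒even (suc zero) ()
suc-odd⇒even (suc (suc n)) e = suc-odd⇒even n e

odd≢even : ∀ {n} → n % 2 ≡ 1 → n % 2 ≢ 0
odd≢even odd even with trans (sym odd) even
... | ()

-- Doubling.  The compressed cell (a+1 , b+1) sits at (2a+1 , 2b+1).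

double : ℕ → ℕ
double zero = zero
double (suc n) = suc (suc (double n))

expand : ℕ → ℕ
expand zero = zero
expand (suc a) = suc (double a)

expandCell : Cell → Cell
expandCell (r , c) = (expand r , expand c)

double≡2* : ∀ a → double a ≡ 2 * a
double≡2* zero = refl
double≡2* (suc a) = cong suc (trans (cong suc (double≡2* a)) (sym (+-suc a (a + 0))))

double-injective : ∀ {a b} → double a ≡ double b → a ≡ b
double-injective {zero} {zero} _ = refl
double-injective {suc a} {suc b} e = cong suc (double-injective (suc-injective (suc-injective e)))

expand-injective : ∀ {a b} → expand a ≡ expand b → a ≡ b
expand-injective {zero} {zero} _ = refl
expand-injective {suc a} {suc b} e = cong suc (double-injective (suc-injective e))

expandCell-injective : ∀ {x y} → expandCell x ≡ expandCell y → x ≡ y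
expandCell-injective e = cong₂ _,_ (expand-injective (cong proj₁ e)) (expand-injective (cong proj₂ e))

double≢odd : ∀ a b → double a ≢ suc (double b)
double≢odd zero b ()
double≢odd (suc a) zero e with suc-injective e
... | ()
double≢odd (suc a) (suc b) e = double≢odd a b (suc-injective (suc-injective e))

double-even : ∀ a → double a % 2 ≡ 0
double-even zero = refl
double-even (suc a) = double-even a

suc-double-odd : ∀ a → suc (double a) % 2 ≡ 1
suc-double-odd zero = refl
suc-double-odd (suc a) = suc-double-odd a

double+-parity : ∀ a n → (double a + n) % 2 ≡ n % 2
double+-parity zero n = refl
double+-parity (suc a) n = double+-parity a n

double-mono : ∀ {a b} → a ≤ b → double a ≤ double b
double-mono z≤n = z≤n
double-mono (s≤s le) = s≤s (s≤s (double-mono le))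

double-cancel-≤ : ∀ {a b} → double a ≤ double b → a ≤ b
double-cancel-≤ {zero} _ = z≤n
double-cancel-≤ {suc a} {suc b} (s≤s (s≤s le)) = s≤s (double-cancel-≤ le)

odd-form : ∀ R → R % 2 ≡ 1 → R ≡ suc (double ⌊ R /2⌋)
odd-form zero ()
odd-form (suc zero) _ = refl
odd-form (suc (suc R)) o = cong (λ z → suc (suc z)) (odd-form R o)

⌈odd/2⌉ : ∀ R → R % 2 ≡ 1 → ⌈ R /2⌉ ≡ suc ⌊ R /2⌋
⌈odd/2⌉ zero ()
⌈odd/2⌉ (suc zero) _ = refl
⌈odd/2⌉ (suc (suc R)) o = cong suc (⌈odd/2⌉ R o)

expand-⌈odd/2⌉ : ∀ R → R % 2 ≡ 1 → expand ⌈ R /2⌉ ≡ R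
expand-⌈odd/2⌉ R odd rewrite ⌈odd/2⌉ R odd = sym (odd-form R odd)

range : ℕ → List ℕ
range K = applyUpTo suc K

∈range⁺ : ∀ {K c} → 1 ≤ c → c ≤ K → c ∈ range K
∈range⁺ {K} {suc c} _ c≤K = ∈-applyUpTo⁺ suc c≤K

∈range⁻ : ∀ {K c} → c ∈ range K → 1 ≤ c × c ≤ K
∈range⁻ m with ∈-applyUpTo⁻ suc m
... | i , i<K , refl = s≤s z≤n , i<K

range-unique : ∀ K → Unique (range K)
range-unique K = Uniqueₚ.applyUpTo⁺₁ suc K (λ i<j _ e → <⇒≢ i<j (suc-injective e))

square : ℕ → List Cell
square K = cartesianProduct (range K) (range K)

∈square⁺ : ∀ {K} x → InSq K x → x ∈ square K
∈square⁺ (r , c) (1≤r , r≤K , 1≤c , c≤K) = ∈-cartesianProduct⁺ (∈range⁺ 1≤r r≤K) (∈range⁺ 1≤c c≤K)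

∈square⁻ : ∀ {K} x → x ∈ square K → InSq K x
∈square⁻ {K} (r , c) m with ∈-cartesianProduct⁻ (range K) (range K) m
... | r∈ , c∈ = proj₁ (∈range⁻ r∈) , proj₂ (∈range⁻ r∈) , proj₁ (∈range⁻ c∈) , proj₂ (∈range⁻ c∈)

square-unique : ∀ K → Unique (square K)
square-unique K = Uniqueₚ.cartesianProduct⁺ (range-unique K) (range-unique K)

length-cartesianProduct : ∀ {X Y : Set} (xs : List X) (ys : List Y) →
  length (cartesianProduct xs ys) ≡ length xs * length ys
length-cartesianProduct [] ys = refl
length-cartesianProduct (x ∷ xs) ys =
  trans (length-++ (map (x ,_) ys)) (cong₂ _+_ (length-map (x ,_) ys) (length-cartesianProduct xs ys))

square-length : ∀ K → length (square K) ≡ K * K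
square-length K = trans (length-cartesianProduct (range K) (range K))
                        (cong₂ _*_ (length-applyUpTo suc K) (length-applyUpTo suc K))

IsCorner : ℕ → Cell → Set
IsCorner K (r , c) = (r ≡ 1 ⊎ r ≡ K) × (c ≡ 1 ⊎ c ≡ K)

record CornerNeighbours (K : ℕ) (κ : Cell) : Set where
  field
    v₁ v₂ : Cell
    v₁-adj : Adj v₁ κ
    v₂-adj : Adj v₂ κ
    v₁-in : InSq K v₁
    v₂-in : InSq K v₂
    v₁≢v₂ : v₁ ≢ v₂
    v₁-or-v₂ : ∀ x → InSq K x → Adj x κ → x ≡ v₁ ⊎ x ≡ v₂

cornerNeighbours : ∀ K → 2 ≤ K → ∀ κ → IsCorner K κ → CornerNeighbours K κ
cornerNeighbours (suc (suc k)) (s≤s (s≤s _)) _ (inj₁ refl , inj₁ refl) = record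
  { v₁ = (2 , 1) ; v₂ = (1 , 2) ; v₁-adj = up ; v₂-adj = left
  ; v₁-in = s≤s z≤n , s≤s (s≤s z≤n) , s≤s z≤n , s≤s z≤n
  ; v₂-in = s≤s z≤n , s≤s z≤n , s≤s z≤n , s≤s (s≤s z≤n)
  ; v₁≢v₂ = λ () ; v₁-or-v₂ = complete }
  where
  complete : ∀ x → InSq (suc (suc k)) x → Adj x (1 , 1) → x ≡ (2 , 1) ⊎ x ≡ (1 , 2)
  complete _ (() , _) down
  complete _ _ up = inj₁ refl
  complete _ (_ , _ , () , _) right
  complete _ _ left = inj₂ refl
cornerNeighbours (suc (suc k)) (s≤s (s≤s _)) _ (inj₁ refl , inj₂ refl) = record
  { v₁ = (2 , suc (suc k)) ; v₂ = (1 , suc k) ; v₁-adj = up ; v₂-adj = right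
  ; v₁-in = s≤s z≤n , s≤s (s≤s z≤n) , s≤s z≤n , ≤-refl
  ; v₂-in = s≤s z≤n , s≤s z≤n , s≤s z≤n , n≤1+n _
  ; v₁≢v₂ = λ () ; v₁-or-v₂ = complete }
  where
  complete : ∀ x → InSq (suc (suc k)) x → Adj x (1 , suc (suc k)) → x ≡ (2 , suc (suc k)) ⊎ x ≡ (1 , suc k)
  complete _ (() , _) down
  complete _ _ up = inj₁ refl
  complete _ _ right = inj₂ refl
  complete _ (_ , _ , _ , c≤K) left = ⊥-elim (1+n≰n c≤K)
cornerNeighbours (suc (suc k)) (s≤s (s≤s _)) _ (inj₂ refl , inj₁ refl) = record
  { v₁ = (suc k , 1) ; v₂ = (suc (suc k) , 2) ; v₁-adj = down ; v₂-adj = left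
  ; v₁-in = s≤s z≤n , n≤1+n _ , s≤s z≤n , s≤s z≤n
  ; v₂-in = s≤s z≤n , ≤-refl , s≤s z≤n , s≤s (s≤s z≤n)
  ; v₁≢v₂ = λ e → 1+n≢n (sym (cong proj₁ e)) ; v₁-or-v₂ = complete }
  where
  complete : ∀ x → InSq (suc (suc k)) x → Adj x (suc (suc k) , 1) → x ≡ (suc k , 1) ⊎ x ≡ (suc (suc k) , 2)
  complete _ _ down = inj₁ refl
  complete _ (_ , r≤K , _) up = ⊥-elim (1+n≰n r≤K)
  complete _ (_ , _ , () , _) right
  complete _ _ left = inj₂ refl
cornerNeighbours (suc (suc k)) (s≤s (s≤s _)) _ (inj₂ refl , inj₂ refl) = record
  { v₁ = (suc k , suc (suc k)) ; v₂ = (suc (suc k) , suc k) ; v₁-adj = down ; v₂-adj = right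
  ; v₁-in = s≤s z≤n , n≤1+n _ , s≤s z≤n , ≤-refl
  ; v₂-in = s≤s z≤n , ≤-refl , s≤s z≤n , n≤1+n _
  ; v₁≢v₂ = λ e → 1+n≢n (sym (cong proj₁ e)) ; v₁-or-v₂ = complete }
  where
  complete : ∀ x → InSq (suc (suc k)) x → Adj x (suc (suc k) , suc (suc k)) →
             x ≡ (suc k , suc (suc k)) ⊎ x ≡ (suc (suc k) , suc k)
  complete _ _ down = inj₁ refl
  complete _ (_ , r≤K , _) up = ⊥-elim (1+n≰n r≤K)
  complete _ _ right = inj₂ refl
  complete _ (_ , _ , _ , c≤K) left = ⊥-elim (1+n≰n c≤K)

-- The criterion: one empty corner, all other empty cells isolated

EmptiesIsolated : ∀ {K} → Arr K → Cell → Set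
EmptiesIsolated {K} B κ = ∀ x y → InSq K x → x ≢ κ → atc B x ≡ false → Adj x y → atc B y ≡ true

module SingleEmptyCorner {K : ℕ} (B : Arr K) (K≥2 : 2 ≤ K) (r₀ c₀ : ℕ)
  (κ-corner : IsCorner K (r₀ , c₀)) (κ-empty : at B r₀ c₀ ≡ false)
  (isolated : EmptiesIsolated B (r₀ , c₀)) where

  κ : Cell
  κ = (r₀ , c₀)

  boundary-in-range : ∀ {r} → r ≡ 1 ⊎ r ≡ K → 1 ≤ r × r ≤ K
  boundary-in-range (inj₁ refl) = s≤s z≤n , ≤-trans (s≤s z≤n) K≥2
  boundary-in-range (inj₂ refl) = ≤-trans (s≤s z≤n) K≥2 , ≤-refl

  κ-in : InSq K κ
  κ-in = let (1≤r , r≤K) = boundary-in-range (proj₁ κ-corner)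
             (1≤c , c≤K) = boundary-in-range (proj₂ κ-corner)
         in 1≤r , r≤K , 1≤c , c≤K

  ≤K⇒≤1+K : ∀ {a} → a ≤ K → a ≤ suc K
  ≤K⇒≤1+K a≤K = ≤-trans a≤K (n≤1+n K)

  -- A path of empty cells starting outside the square or at κ stays there:
  -- entering the square elsewhere would put an empty cell next to an empty one.
  outer-invariant : ∀ {a x} → Path (EmptyBox B) a x → (¬ InSq K a ⊎ a ≡ κ) → (¬ InSq K x ⊎ x ≡ κ)
  outer-invariant (here _) inv = inv
  outer-invariant {a} (step {y = y} a-empty a→y rest) _ with inSq? K y | y ≟c κ
  ... | no y∉ | _ = outer-invariant rest (inj₁ y∉)
  ... | yes _ | yes y≡κ = outer-invariant rest (inj₂ y≡κ)
  ... | yes y∈ | no y≢κ = ⊥-elim (tile≢empty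
        (isolated y a y∈ y≢κ (proj₂ (proj₂ (path-head rest))) (adj-sym a→y))
        (proj₂ (proj₂ a-empty)))

  outer⇒outside-or-κ : ∀ x → Outer B x → ¬ InSq K x ⊎ x ≡ κ
  outer⇒outside-or-κ x p = outer-invariant p (inj₁ λ { (() , _) })

  top-ring : ∀ c → c ≤ suc K → Outer B (0 , c)
  top-ring zero _ = here (z≤n , z≤n , refl)
  top-ring (suc c) c≤ = path-snoc (top-ring c (≤-trans (n≤1+n c) c≤)) right (z≤n , c≤ , refl)

  left-ring : ∀ r → r ≤ suc K → Outer B (r , 0)
  left-ring zero _ = here (z≤n , z≤n , refl)
  left-ring (suc r) r≤ = path-snoc (left-ring r (≤-trans (n≤1+n r) r≤)) down (r≤ , z≤n , refl)

  right-ring : ∀ r → r ≤ suc K → Outer B (r , suc K)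
  right-ring zero _ = top-ring (suc K) ≤-refl
  right-ring (suc r) r≤ = path-snoc (right-ring r (≤-trans (n≤1+n r) r≤)) down
    (r≤ , ≤-refl , outside⇒empty B _ (λ x∈ → 1+n≰n (proj₂ (proj₂ (proj₂ x∈)))))

  bottom-ring : ∀ c → c ≤ suc K → Outer B (suc K , c)
  bottom-ring zero _ = left-ring (suc K) ≤-refl
  bottom-ring (suc c) c≤ = path-snoc (bottom-ring c (≤-trans (n≤1+n c) c≤)) right
    (≤-refl , c≤ , outside⇒empty B _ (λ x∈ → 1+n≰n (proj₁ (proj₂ x∈))))

  outside⇒outer : ∀ r c → r ≤ suc K → c ≤ suc K → ¬ InSq K (r , c) → Outer B (r , c)
  outside⇒outer zero c _ c≤ _ = top-ring c c≤
  outside⇒outer (suc r) zero r≤ _ _ = left-ring (suc r) r≤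
  outside⇒outer (suc r) (suc c) r≤ c≤ x∉ with K <? suc r | K <? suc c
  ... | yes K<r | _ = subst (λ t → Outer B (t , suc c)) (sym (≤-antisym r≤ K<r)) (bottom-ring (suc c) c≤)
  ... | no _ | yes K<c = subst (λ t → Outer B (suc r , t)) (sym (≤-antisym c≤ K<c)) (right-ring (suc r) r≤)
  ... | no K≮r | no K≮c = ⊥-elim (x∉ (s≤s z≤n , ≮⇒≥ K≮r , s≤s z≤n , ≮⇒≥ K≮c))

  κ-outer : Outer B κ
  κ-outer = reach r₀ c₀ (proj₁ κ-corner) (proj₂ (proj₂ (proj₂ κ-in))) κ-empty
    where
    reach : ∀ r c → r ≡ 1 ⊎ r ≡ K → c ≤ K → at B r c ≡ false → Outer B (r , c)
    reach r c (inj₁ refl) c≤K e = path-snoc (top-ring c (≤K⇒≤1+K c≤K)) down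
      (≤-trans (s≤s z≤n) (≤K⇒≤1+K K≥2) , ≤K⇒≤1+K c≤K , e)
    reach r c (inj₂ refl) c≤K e = path-snoc (bottom-ring c (≤K⇒≤1+K c≤K)) up
      (n≤1+n K , ≤K⇒≤1+K c≤K , e)

  hole-cell⇒ : ∀ x → HoleCell B x → InSq K x × x ≢ κ
  hole-cell⇒ (r , c) ((r≤ , c≤ , _) , ¬outer) with inSq? K (r , c) | (r , c) ≟c κ
  ... | no x∉ | _ = ⊥-elim (¬outer (outside⇒outer r c r≤ c≤ x∉))
  ... | yes _ | yes x≡κ = ⊥-elim (¬outer (subst (Outer B) (sym x≡κ) κ-outer))
  ... | yes x∈ | no x≢κ = x∈ , x≢κ

  holes-unit : HolesUnit B
  holes-unit x y hole (here _) = refl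
  holes-unit x y hole (step x-empty x→ rest) = ⊥-elim (tile≢empty
    (isolated x _ (proj₁ (hole-cell⇒ x hole)) (proj₂ (hole-cell⇒ x hole)) (proj₂ (proj₂ x-empty)) x→)
    (proj₂ (proj₂ (path-head rest))))

  filled? : (x : Cell) → Dec (Filled B x)
  filled? x = atc B x Boolₚ.≟ true

  HoleCandidate : Cell → Set
  HoleCandidate x = atc B x ≡ false × x ≢ κ

  hole? : (x : Cell) → Dec (HoleCandidate x)
  hole? x = (atc B x Boolₚ.≟ false) ×-dec (¬? (x ≟c κ))

  tiles holes : List Cell
  tiles = filter filled? (square K)
  holes = filter hole? (square K)

  card-tiles : Card (Filled B) (length tiles)
  card-tiles = tiles , Uniqueₚ.filter⁺ filled? (square-unique K)
    , (λ x m → proj₂ (∈-filter⁻ filled? {xs = square K} m))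
    , (λ x f → ∈-filter⁺ filled? (∈square⁺ x (filled⇒inSq B _ _ f)) f) , refl

  card-holes : Card (HoleRep B) (length holes)
  card-holes = holes , Uniqueₚ.filter⁺ hole? (square-unique K) , sound , complete , refl
    where
    sound : ∀ x → x ∈ holes → HoleRep B x
    sound x m with ∈-filter⁻ hole? {xs = square K} m
    ... | x∈sq , (x-empty , x≢κ) = hole , least
      where
      x∈ : InSq K x
      x∈ = ∈square⁻ x x∈sq
      hole : HoleCell B x
      hole = (≤K⇒≤1+K (proj₁ (proj₂ x∈)) , ≤K⇒≤1+K (proj₂ (proj₂ (proj₂ x∈))) , x-empty)
           , λ o → Sum.[ (λ x∉ → x∉ x∈) , x≢κ ] (outer⇒outside-or-κ x o)
      least : ∀ y → Path (EmptyBox B) x y → _≤lex_ B x y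
      least y p = subst (_≤lex_ B x) (holes-unit x y hole p) (inj₂ (refl , ≤-refl))
    complete : ∀ x → HoleRep B x → x ∈ holes
    complete x (hole , _) = ∈-filter⁺ hole? (∈square⁺ x (proj₁ (hole-cell⇒ x hole)))
      (proj₂ (proj₂ (proj₁ hole)) , proj₂ (hole-cell⇒ x hole))

  tiles+holes+1 : length tiles + length holes + 1 ≡ K * K
  tiles+holes+1 = trans (cong (length tiles + length holes +_) (sym κ-once))
    (trans (count-partition₃ filled? hole? (_≟c κ) (square K) cover tile-hole tile-κ hole-κ)
           (square-length K))
    where
    κ-once : length (filter (_≟c κ) (square K)) ≡ 1
    κ-once = count-one (_≟c κ) (square K) κ (square-unique K) (∈square⁺ κ κ-in) (λ _ _ → (λ e → e) , (λ e → e))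
    cover : ∀ x → Filled B x ⊎ HoleCandidate x ⊎ x ≡ κ
    cover x with atc B x in e | x ≟c κ
    ... | true | _ = inj₁ refl
    ... | false | yes x≡κ = inj₂ (inj₂ x≡κ)
    ... | false | no x≢κ = inj₂ (inj₁ (refl , x≢κ))
    tile-hole : ∀ x → Filled B x → ¬ HoleCandidate x
    tile-hole x f (e , _) = tile≢empty f e
    tile-κ : ∀ x → Filled B x → x ≢ κ
    tile-κ x f refl = tile≢empty f κ-empty
    hole-κ : ∀ x → HoleCandidate x → x ≢ κ
    hole-κ x (_ , x≢κ) = x≢κ

  -- Outer perimeter: the 4K edges leaving the square, except the two
  -- leaving κ, plus the two edges from the neighbours of κ into κ.

  Edge : Set
  Edge = Cell × Cell

  topEdges bottomEdges leftEdges rightEdges boundaryEdges : List Edge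
  topEdges = map (λ c → ((1 , c) , (0 , c))) (range K)
  bottomEdges = map (λ c → ((K , c) , (suc K , c))) (range K)
  leftEdges = map (λ r → ((r , 1) , (r , 0))) (range K)
  rightEdges = map (λ r → ((r , K) , (r , suc K))) (range K)
  boundaryEdges = topEdges ++ bottomEdges ++ leftEdges ++ rightEdges

  LeavesSquare : Edge → Set
  LeavesSquare (x , (r , c)) = InSq K x × Adj x (r , c) × ¬ InSq K (r , c) × r ≤ suc K × c ≤ suc K

  boundaryEdge-leaves : ∀ e → e ∈ boundaryEdges → LeavesSquare e
  boundaryEdge-leaves e m with ∈-++⁻ topEdges m
  ... | inj₁ m₁ with ∈-map⁻ _ m₁
  ...   | c , c∈ , refl = (s≤s z≤n , ≤-trans (s≤s z≤n) K≥2 , ∈range⁻ c∈) , up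
                        , (λ { (() , _) }) , z≤n , ≤K⇒≤1+K (proj₂ (∈range⁻ c∈))
  boundaryEdge-leaves e m | inj₂ m' with ∈-++⁻ bottomEdges m'
  ... | inj₁ m₁ with ∈-map⁻ _ m₁
  ...   | c , c∈ , refl = (≤-trans (s≤s z≤n) K≥2 , ≤-refl , ∈range⁻ c∈) , down
                        , (λ x∈ → 1+n≰n (proj₁ (proj₂ x∈))) , ≤-refl , ≤K⇒≤1+K (proj₂ (∈range⁻ c∈))
  boundaryEdge-leaves e m | inj₂ m' | inj₂ m'' with ∈-++⁻ leftEdges m''
  ... | inj₁ m₁ with ∈-map⁻ _ m₁
  ...   | r , r∈ , refl = (proj₁ (∈range⁻ r∈) , proj₂ (∈range⁻ r∈) , s≤s z≤n , ≤-trans (s≤s z≤n) K≥2) , left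
                        , (λ { (_ , _ , () , _) }) , ≤K⇒≤1+K (proj₂ (∈range⁻ r∈)) , z≤n
  boundaryEdge-leaves e m | inj₂ m' | inj₂ m'' | inj₂ m₁ with ∈-map⁻ _ m₁
  ... | r , r∈ , refl = (proj₁ (∈range⁻ r∈) , proj₂ (∈range⁻ r∈) , ≤-trans (s≤s z≤n) K≥2 , ≤-refl) , right
                      , (λ x∈ → 1+n≰n (proj₂ (proj₂ (proj₂ x∈)))) , ≤K⇒≤1+K (proj₂ (∈range⁻ r∈)) , ≤-refl

  boundaryEdge-complete : ∀ {x y} → InSq K x → Adj x y → ¬ InSq K y → (x , y) ∈ boundaryEdges
  boundaryEdge-complete {r , c} (1≤r , r≤K , 1≤c , c≤K) down y∉ =
    subst (λ t → ((t , c) , (suc t , c)) ∈ boundaryEdges)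
      (sym (≤-antisym r≤K (≮⇒≥ λ r<K → y∉ (s≤s z≤n , r<K , 1≤c , c≤K))))
      (∈-++⁺ʳ topEdges (∈-++⁺ˡ (∈-map⁺ _ (∈range⁺ 1≤c c≤K))))
  boundaryEdge-complete {suc zero , c} (_ , _ , 1≤c , c≤K) up y∉ = ∈-++⁺ˡ (∈-map⁺ _ (∈range⁺ 1≤c c≤K))
  boundaryEdge-complete {suc (suc r) , c} (_ , r≤K , 1≤c , c≤K) up y∉ =
    ⊥-elim (y∉ (s≤s z≤n , ≤-trans (n≤1+n _) r≤K , 1≤c , c≤K))
  boundaryEdge-complete {r , c} (1≤r , r≤K , 1≤c , c≤K) right y∉ =
    subst (λ t → ((r , t) , (r , suc t)) ∈ boundaryEdges)
      (sym (≤-antisym c≤K (≮⇒≥ λ c<K → y∉ (1≤r , r≤K , s≤s z≤n , c<K))))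
      (∈-++⁺ʳ topEdges (∈-++⁺ʳ bottomEdges (∈-++⁺ʳ leftEdges (∈-map⁺ _ (∈range⁺ 1≤r r≤K)))))
  boundaryEdge-complete {r , suc zero} (1≤r , r≤K , _ , _) left y∉ =
    ∈-++⁺ʳ topEdges (∈-++⁺ʳ bottomEdges (∈-++⁺ˡ (∈-map⁺ _ (∈range⁺ 1≤r r≤K))))
  boundaryEdge-complete {r , suc (suc c)} (1≤r , r≤K , _ , c≤K) left y∉ =
    ⊥-elim (y∉ (1≤r , r≤K , s≤s z≤n , ≤-trans (n≤1+n _) c≤K))

  boundaryEdges-unique : Unique boundaryEdges
  boundaryEdges-unique =
    Uniqueₚ.++⁺ (Uniqueₚ.map⁺ (cong target-col) (range-unique K))
      (Uniqueₚ.++⁺ (Uniqueₚ.map⁺ (cong target-col) (range-unique K))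
        (Uniqueₚ.++⁺ (Uniqueₚ.map⁺ (cong target-row) (range-unique K))
                     (Uniqueₚ.map⁺ (cong target-row) (range-unique K)) left∩right)
        bottom∩sides)
      top∩rest
    where
    target-row target-col : Edge → ℕ
    target-row e = proj₁ (proj₂ e)
    target-col e = proj₂ (proj₂ e)
    left∩right : ∀ {e} → ¬ (e ∈ leftEdges × e ∈ rightEdges)
    left∩right (m₁ , m₂) with ∈-map⁻ _ m₁ | ∈-map⁻ _ m₂
    ... | _ , _ , refl | _ , _ , ()
    side-row≤K : ∀ {e} → e ∈ leftEdges ++ rightEdges → target-row e ≤ K
    side-row≤K m with ∈-++⁻ leftEdges m
    ... | inj₁ m' with ∈-map⁻ _ m'
    ...   | _ , r∈ , refl = proj₂ (∈range⁻ r∈)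
    side-row≤K m | inj₂ m' with ∈-map⁻ _ m'
    ...   | _ , r∈ , refl = proj₂ (∈range⁻ r∈)
    bottom∩sides : ∀ {e} → ¬ (e ∈ bottomEdges × e ∈ leftEdges ++ rightEdges)
    bottom∩sides (m₁ , m₂) with ∈-map⁻ _ m₁
    ... | _ , _ , refl = 1+n≰n (side-row≤K m₂)
    rest-row≥1 : ∀ {e} → e ∈ bottomEdges ++ leftEdges ++ rightEdges → 1 ≤ target-row e
    rest-row≥1 m with ∈-++⁻ bottomEdges m
    ... | inj₁ m' with ∈-map⁻ _ m'
    ...   | _ , _ , refl = s≤s z≤n
    rest-row≥1 m | inj₂ m' with ∈-++⁻ leftEdges m'
    ... | inj₁ m'' with ∈-map⁻ _ m''
    ...   | _ , r∈ , refl = proj₁ (∈range⁻ r∈)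
    rest-row≥1 m | inj₂ m' | inj₂ m'' with ∈-map⁻ _ m''
    ...   | _ , r∈ , refl = proj₁ (∈range⁻ r∈)
    top∩rest : ∀ {e} → ¬ (e ∈ topEdges × e ∈ bottomEdges ++ leftEdges ++ rightEdges)
    top∩rest (m₁ , m₂) with ∈-map⁻ _ m₁
    ... | _ , _ , refl with rest-row≥1 m₂
    ... | ()

  -- exactly two boundary edges leave κ: one on a horizontal side, one on a vertical side
  leaves-κ? : (e : Edge) → Dec (proj₁ e ≡ κ)
  leaves-κ? e = proj₁ e ≟c κ

  1≢K : 1 ≢ K
  1≢K 1≡K = 1+n≰n (subst (2 ≤_) (sym 1≡K) K≥2)

  row-count : ℕ → ℕ
  row-count a = length (filter (λ c → (a , c) ≟c κ) (range K))

  col-count : ℕ → ℕ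
  col-count a = length (filter (λ r → (r , a) ≟c κ) (range K))

  row-count-κ : ∀ a → a ≡ r₀ → row-count a ≡ 1
  row-count-κ a a≡r₀ = count-one (λ c → (a , c) ≟c κ) (range K) c₀ (range-unique K)
    (∈range⁺ (proj₁ (proj₂ (proj₂ κ-in))) (proj₂ (proj₂ (proj₂ κ-in))))
    (λ _ _ → cong proj₂ , cong₂ _,_ a≡r₀)

  row-count-other : ∀ a → a ≢ r₀ → row-count a ≡ 0
  row-count-other a a≢r₀ = count-zero (λ c → (a , c) ≟c κ) (range K) (λ _ _ e → a≢r₀ (cong proj₁ e))

  col-count-κ : ∀ a → a ≡ c₀ → col-count a ≡ 1
  col-count-κ a a≡c₀ = count-one (λ r → (r , a) ≟c κ) (range K) r₀ (range-unique K)
    (∈range⁺ (proj₁ κ-in) (proj₁ (proj₂ κ-in)))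
    (λ _ _ → cong proj₁ , λ e → cong₂ _,_ e a≡c₀)

  col-count-other : ∀ a → a ≢ c₀ → col-count a ≡ 0
  col-count-other a a≢c₀ = count-zero (λ r → (r , a) ≟c κ) (range K) (λ _ _ e → a≢c₀ (cong proj₂ e))

  top+bottom : row-count 1 + row-count K ≡ 1
  top+bottom with proj₁ κ-corner
  ... | inj₁ r₀≡1 =
    cong₂ _+_ (row-count-κ 1 (sym r₀≡1)) (row-count-other K (λ e → 1≢K (trans (sym r₀≡1) (sym e))))
  ... | inj₂ r₀≡K = cong₂ _+_ (row-count-other 1 (λ e → 1≢K (trans e r₀≡K))) (row-count-κ K (sym r₀≡K))

  left+right : col-count 1 + col-count K ≡ 1
  left+right with proj₂ κ-corner
  ... | inj₁ c₀≡1 =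
    cong₂ _+_ (col-count-κ 1 (sym c₀≡1)) (col-count-other K (λ e → 1≢K (trans (sym c₀≡1) (sym e))))
  ... | inj₂ c₀≡K = cong₂ _+_ (col-count-other 1 (λ e → 1≢K (trans e c₀≡K))) (col-count-κ K (sym c₀≡K))

  κ-boundaryEdges : length (filter leaves-κ? boundaryEdges) ≡ 2
  κ-boundaryEdges = begin
      length (filter leaves-κ? boundaryEdges)
    ≡⟨ count-++ leaves-κ? topEdges _ ⟩
      count topEdges + length (filter leaves-κ? (bottomEdges ++ leftEdges ++ rightEdges))
    ≡⟨ cong (count topEdges +_) (count-++ leaves-κ? bottomEdges _) ⟩
      count topEdges + (count bottomEdges + length (filter leaves-κ? (leftEdges ++ rightEdges)))
    ≡⟨ cong (λ z → count topEdges + (count bottomEdges + z)) (count-++ leaves-κ? leftEdges rightEdges) ⟩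
      count topEdges + (count bottomEdges + (count leftEdges + count rightEdges))
    ≡⟨ sym (+-assoc (count topEdges) _ _) ⟩
      (count topEdges + count bottomEdges) + (count leftEdges + count rightEdges)
    ≡⟨ cong₂ _+_ (cong₂ _+_ (count-map leaves-κ? _ (range K)) (count-map leaves-κ? _ (range K)))
                 (cong₂ _+_ (count-map leaves-κ? _ (range K)) (count-map leaves-κ? _ (range K))) ⟩
      (row-count 1 + row-count K) + (col-count 1 + col-count K)
    ≡⟨ cong₂ _+_ top+bottom left+right ⟩
      2 ∎
    where
    open ≡-Reasoning
    count : List Edge → ℕ
    count es = length (filter leaves-κ? es)

  boundaryEdges-length : length boundaryEdges ≡ 2 * (2 * K)
  boundaryEdges-length = trans (trans (length-++ topEdges) (cong₂ _+_ side (trans (length-++ bottomEdges)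
      (cong₂ _+_ side (trans (length-++ leftEdges) (cong₂ _+_ side side))))))
    (four-sides K)
    where
    side : ∀ {f : ℕ → Edge} → length (map f (range K)) ≡ K
    side {f} = trans (length-map f (range K)) (length-applyUpTo suc K)
    four-sides : ∀ K → K + (K + (K + K)) ≡ 2 * (2 * K)
    four-sides = solve-∀

  open CornerNeighbours (cornerNeighbours K K≥2 κ κ-corner)

  κ-neighbour-filled : ∀ v → InSq K v → Adj v κ → Filled B v
  κ-neighbour-filled v v∈ v→κ with atc B v in e
  ... | true = refl
  ... | false = ⊥-elim (tile≢empty (isolated v κ v∈ (adj-≢ v→κ) e v→κ) κ-empty)

  source-filled? : (e : Edge) → Dec (Filled B (proj₁ e))
  source-filled? e = filled? (proj₁ e)

  outerEdges : List Edge
  outerEdges = filter source-filled? boundaryEdges ++ (v₁ , κ) ∷ (v₂ , κ) ∷ []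

  -- a boundary edge has an empty source exactly when it leaves κ
  unfilled-sources : length (filter (λ e → ¬? (source-filled? e)) boundaryEdges) ≡ 2
  unfilled-sources = trans (count-cong (λ e → ¬? (source-filled? e)) leaves-κ? boundaryEdges same) κ-boundaryEdges
    where
    same : ∀ e → e ∈ boundaryEdges → (¬ Filled B (proj₁ e) → proj₁ e ≡ κ) × (proj₁ e ≡ κ → ¬ Filled B (proj₁ e))
    same e m = empty⇒κ , (λ e≡κ f → tile≢empty f (trans (cong (atc B) e≡κ) κ-empty))
      where
      empty⇒κ : ¬ Filled B (proj₁ e) → proj₁ e ≡ κ
      empty⇒κ ¬f with proj₁ e ≟c κ
      ... | yes e≡κ = e≡κ
      ... | no e≢κ with boundaryEdge-leaves e m
      ... | x∈ , x→y , y∉ , _ =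
        ⊥-elim (tile≢empty (isolated _ _ x∈ e≢κ (≢true⇒≡false ¬f) x→y) (outside⇒empty B _ y∉))

  outerEdges-length : length outerEdges ≡ 2 * (2 * K)
  outerEdges-length = begin
      length outerEdges
    ≡⟨ length-++ (filter source-filled? boundaryEdges) ⟩
      length (filter source-filled? boundaryEdges) + 2
    ≡⟨ cong (length (filter source-filled? boundaryEdges) +_) (sym unfilled-sources) ⟩
      length (filter source-filled? boundaryEdges) + length (filter (λ e → ¬? (source-filled? e)) boundaryEdges)
    ≡⟨ count-split source-filled? boundaryEdges ⟩
      length boundaryEdges
    ≡⟨ boundaryEdges-length ⟩
      2 * (2 * K) ∎
    where open ≡-Reasoning

  card-outerEdges : Card (OuterEdge B) (length outerEdges)
  card-outerEdges = outerEdges , unique , sound , complete , refl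
    where
    κ∉boundary-targets : ∀ {e} → e ∈ filter source-filled? boundaryEdges → proj₂ e ≢ κ
    κ∉boundary-targets m e≡κ = proj₁ (proj₂ (proj₂ (boundaryEdge-leaves _ (proj₁ (∈-filter⁻ source-filled? m)))))
                                  (subst (InSq K) (sym e≡κ) κ-in)
    unique : Unique outerEdges
    unique = Uniqueₚ.++⁺ (Uniqueₚ.filter⁺ source-filled? boundaryEdges-unique)
      (((λ e → v₁≢v₂ (cong proj₁ e)) ∷ []) ∷ [] ∷ [])
      λ { (m , here refl) → κ∉boundary-targets m refl ; (m , there (here refl)) → κ∉boundary-targets m refl }
    sound : ∀ e → e ∈ outerEdges → OuterEdge B e
    sound e m with ∈-++⁻ (filter source-filled? boundaryEdges) m
    ... | inj₁ m₁ with ∈-filter⁻ source-filled? {xs = boundaryEdges} m₁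
    ...   | m₂ , f with boundaryEdge-leaves e m₂
    ...     | _ , x→y , y∉ , r≤ , c≤ = f , x→y , outside⇒outer _ _ r≤ c≤ y∉
    sound e m | inj₂ (here refl) = κ-neighbour-filled v₁ v₁-in v₁-adj , v₁-adj , κ-outer
    sound e m | inj₂ (there (here refl)) = κ-neighbour-filled v₂ v₂-in v₂-adj , v₂-adj , κ-outer
    complete : ∀ e → OuterEdge B e → e ∈ outerEdges
    complete (x , y) (f , x→y , y-outer) with outer⇒outside-or-κ y y-outer
    ... | inj₁ y∉ = ∈-++⁺ˡ (∈-filter⁺ source-filled? (boundaryEdge-complete (filled⇒inSq B _ _ f) x→y y∉) f)
    ... | inj₂ refl with v₁-or-v₂ x (filled⇒inSq B _ _ f) x→y
    ...   | inj₁ refl = ∈-++⁺ʳ (filter source-filled? boundaryEdges) (here refl)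
    ...   | inj₂ refl = ∈-++⁺ʳ (filter source-filled? boundaryEdges) (there (here refl))

  efficient : Acyclic B → EffStruct B
  efficient acyclic = acyclic , holes-unit
    , length tiles , length holes , length outerEdges , 2 * K
    , card-tiles , card-holes , card-outerEdges
    , ceilTwoSqrt K _ K≥2 tiles+holes+1 , outerEdges-length

-- An edge x → y between cells of the compressed square is
-- stretched to the walk  expandCell x → midpoint → expandCell y  in the
-- original square; the midpoint has one even coordinate.

Positive : Cell → Set
Positive x = Σ ℕ λ a → Σ ℕ λ b → x ≡ (suc a , suc b)

midpoint : ∀ {x y} → Adj x y → Cell
midpoint (down {r} {c}) = (double r , expand c)
midpoint (up {r} {c}) = (double r , expand c)
midpoint (right {r} {c}) = (expand r , double c)
midpoint (left {r} {c}) = (expand r , double c)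

midpoint-adjˡ : ∀ {x y} (q : Adj x y) → Positive x → Adj (expandCell x) (midpoint q)
midpoint-adjˡ down (_ , _ , refl) = down
midpoint-adjˡ up _ = up
midpoint-adjˡ right (_ , _ , refl) = right
midpoint-adjˡ left _ = left

midpoint-adjʳ : ∀ {x y} (q : Adj x y) → Positive y → Adj (midpoint q) (expandCell y)
midpoint-adjʳ down _ = down
midpoint-adjʳ up (_ , _ , refl) = up
midpoint-adjʳ right _ = right
midpoint-adjʳ left (_ , _ , refl) = left

midpoint≢expand : ∀ {x y z} (q : Adj x y) → Positive z → midpoint q ≢ expandCell z
midpoint≢expand (down {r}) (a , _ , refl) e = double≢odd r a (cong proj₁ e)
midpoint≢expand (up {r}) (a , _ , refl) e = double≢odd r a (cong proj₁ e)
midpoint≢expand (right {c = c}) (_ , b , refl) e = double≢odd c b (cong proj₂ e)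
midpoint≢expand (left {c = c}) (_ , b , refl) e = double≢odd c b (cong proj₂ e)

midpoint-injective : ∀ {a b u v} (p : Adj a b) (q : Adj u v) → Positive a → Positive u →
  midpoint p ≡ midpoint q → (a ≡ u × b ≡ v) ⊎ (a ≡ v × b ≡ u)
midpoint-injective down down _ _ e with double-injective (cong proj₁ e) | expand-injective (cong proj₂ e)
... | refl | refl = inj₁ (refl , refl)
midpoint-injective down up _ _ e with double-injective (cong proj₁ e) | expand-injective (cong proj₂ e)
... | refl | refl = inj₂ (refl , refl)
midpoint-injective up down _ _ e with double-injective (cong proj₁ e) | expand-injective (cong proj₂ e)
... | refl | refl = inj₂ (refl , refl)
midpoint-injective up up _ _ e with double-injective (cong proj₁ e) | expand-injective (cong proj₂ e)
... | refl | refl = inj₁ (refl , refl)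
midpoint-injective right right _ _ e with expand-injective (cong proj₁ e) | double-injective (cong proj₂ e)
... | refl | refl = inj₁ (refl , refl)
midpoint-injective right left _ _ e with expand-injective (cong proj₁ e) | double-injective (cong proj₂ e)
... | refl | refl = inj₂ (refl , refl)
midpoint-injective left right _ _ e with expand-injective (cong proj₁ e) | double-injective (cong proj₂ e)
... | refl | refl = inj₂ (refl , refl)
midpoint-injective left left _ _ e with expand-injective (cong proj₁ e) | double-injective (cong proj₂ e)
... | refl | refl = inj₁ (refl , refl)
midpoint-injective (down {r}) right _ (a , _ , refl) e = ⊥-elim (double≢odd r a (cong proj₁ e))
midpoint-injective (down {r}) left _ (a , _ , refl) e = ⊥-elim (double≢odd r a (cong proj₁ e))
midpoint-injective (up {r}) right _ (a , _ , refl) e = ⊥-elim (double≢odd r a (cong proj₁ e))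
midpoint-injective (up {r}) left _ (a , _ , refl) e = ⊥-elim (double≢odd r a (cong proj₁ e))
midpoint-injective right (down {r}) (a , _ , refl) _ e = ⊥-elim (double≢odd r a (sym (cong proj₁ e)))
midpoint-injective right (up {r}) (a , _ , refl) _ e = ⊥-elim (double≢odd r a (sym (cong proj₁ e)))
midpoint-injective left (down {r}) (a , _ , refl) _ e = ⊥-elim (double≢odd r a (sym (cong proj₁ e)))
midpoint-injective left (up {r}) (a , _ , refl) _ e = ⊥-elim (double≢odd r a (sym (cong proj₁ e)))

EvenEven : Cell → Set
EvenEven (r , c) = r % 2 ≡ 0 × c % 2 ≡ 0

midpoint-neighbours : ∀ {x y w} (q : Adj x y) → Positive x → Adj (midpoint q) w →
  w ≡ expandCell x ⊎ w ≡ expandCell y ⊎ EvenEven w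
midpoint-neighbours (down {suc a} {suc b}) _ down = inj₂ (inj₁ refl)
midpoint-neighbours (down {suc a} {suc b}) _ up = inj₁ refl
midpoint-neighbours (down {suc a} {suc b}) _ right = inj₂ (inj₂ (double-even (suc a) , double-even (suc b)))
midpoint-neighbours (down {suc a} {suc b}) _ left = inj₂ (inj₂ (double-even (suc a) , double-even b))
midpoint-neighbours (up {zero} {suc b}) _ down = inj₁ refl
midpoint-neighbours (up {zero} {suc b}) _ right = inj₂ (inj₂ (refl , double-even (suc b)))
midpoint-neighbours (up {zero} {suc b}) _ left = inj₂ (inj₂ (refl , double-even b))
midpoint-neighbours (up {suc a} {suc b}) _ down = inj₁ refl
midpoint-neighbours (up {suc a} {suc b}) _ up = inj₂ (inj₁ refl)
midpoint-neighbours (up {suc a} {suc b}) _ right = inj₂ (inj₂ (double-even (suc a) , double-even (suc b)))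
midpoint-neighbours (up {suc a} {suc b}) _ left = inj₂ (inj₂ (double-even (suc a) , double-even b))
midpoint-neighbours (right {suc a} {suc b}) _ down = inj₂ (inj₂ (double-even (suc a) , double-even (suc b)))
midpoint-neighbours (right {suc a} {suc b}) _ up = inj₂ (inj₂ (double-even a , double-even (suc b)))
midpoint-neighbours (right {suc a} {suc b}) _ right = inj₂ (inj₁ refl)
midpoint-neighbours (right {suc a} {suc b}) _ left = inj₁ refl
midpoint-neighbours (left {suc a} {zero}) _ down = inj₂ (inj₂ (double-even (suc a) , refl))
midpoint-neighbours (left {suc a} {zero}) _ up = inj₂ (inj₂ (double-even a , refl))
midpoint-neighbours (left {suc a} {zero}) _ right = inj₁ refl
midpoint-neighbours (left {suc a} {suc b}) _ down = inj₂ (inj₂ (double-even (suc a) , double-even (suc b)))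
midpoint-neighbours (left {suc a} {suc b}) _ up = inj₂ (inj₂ (double-even a , double-even (suc b)))
midpoint-neighbours (left {suc a} {suc b}) _ right = inj₁ refl
midpoint-neighbours (left {suc a} {suc b}) _ left = inj₂ (inj₁ refl)
midpoint-neighbours (down {zero}) (_ , _ , ()) _
midpoint-neighbours (down {suc a} {zero}) (_ , _ , ()) _
midpoint-neighbours (up {c = zero}) (_ , _ , ()) _
midpoint-neighbours (right {zero}) (_ , _ , ()) _
midpoint-neighbours (right {suc a} {zero}) (_ , _ , ()) _
midpoint-neighbours (left {zero}) (_ , _ , ()) _

neighbour-is-midpoint : ∀ {x w} → Positive x → Adj (expandCell x) w →
  Σ Cell λ y → Σ (Adj x y) λ q → w ≡ midpoint q
neighbour-is-midpoint (a , b , refl) down = _ , down , refl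
neighbour-is-midpoint (a , b , refl) up = _ , up , refl
neighbour-is-midpoint (a , b , refl) right = _ , right , refl
neighbour-is-midpoint (a , b , refl) left = _ , left , refl

-- Lifting a walk a → b₁ → … → bₖ → z of the compressed square: the cells
-- strictly between expandCell a and expandCell z in the stretched walk.
liftWalk : ∀ a bs z → Linked Adj (a ∷ bs ++ [ z ]) → List Cell
liftWalk a [] z (q ∷ [-]) = midpoint q ∷ []
liftWalk a (b ∷ bs) z (q ∷ rest) = midpoint q ∷ expandCell b ∷ liftWalk b bs z rest

liftWalk-linked : ∀ a bs z (lk : Linked Adj (a ∷ bs ++ [ z ])) → All Positive (a ∷ bs ++ [ z ]) →
  Linked Adj (expandCell a ∷ liftWalk a bs z lk ++ [ expandCell z ])
liftWalk-linked a [] z (q ∷ [-]) (pa ∷ pz ∷ []) = midpoint-adjˡ q pa ∷ midpoint-adjʳ q pz ∷ [-]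
liftWalk-linked a (b ∷ bs) z (q ∷ rest) (pa ∷ pb ∷ ps) =
  midpoint-adjˡ q pa ∷ midpoint-adjʳ q pb ∷ liftWalk-linked b bs z rest (pb ∷ ps)

liftWalk-length : ∀ a b bs z (lk : Linked Adj (a ∷ b ∷ bs ++ [ z ])) → 2 ≤ length (liftWalk a (b ∷ bs) z lk)
liftWalk-length a b bs z (q ∷ rest) = s≤s (s≤s z≤n)

-- the successor of the first vertex of b ∷ bs ++ [ z ]
next : List Cell → Cell → Cell
next [] z = z
next (c ∷ _) z = c

LiftedMidpoint : Cell → Cell → List Cell → Cell → Set
LiftedMidpoint w b bs z = Σ Cell λ u → Σ Cell λ v → Σ (Adj u v) λ q →
  w ≡ midpoint q × Positive u × ((u ≡ b × v ≡ next bs z) ⊎ u ∈ bs)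

LiftedCell : Cell → Cell → List Cell → Cell → Set
LiftedCell w b bs z = (Σ Cell λ c → c ∈ bs × w ≡ expandCell c) ⊎ LiftedMidpoint w b bs z

liftWalk-member : ∀ b bs z (lk : Linked Adj (b ∷ bs ++ [ z ])) → All Positive (b ∷ bs ++ [ z ]) → ∀ {w} →
  w ∈ liftWalk b bs z lk → LiftedCell w b bs z
liftWalk-member b [] z (q ∷ [-]) (pb ∷ _) (here refl) = inj₂ (b , z , q , refl , pb , inj₁ (refl , refl))
liftWalk-member b (c ∷ cs) z (q ∷ rest) (pb ∷ _) (here refl) = inj₂ (b , c , q , refl , pb , inj₁ (refl , refl))
liftWalk-member b (c ∷ cs) z (q ∷ rest) _ (there (here refl)) = inj₁ (c , here refl , refl)
liftWalk-member b (c ∷ cs) z (q ∷ rest) (_ ∷ ps) (there (there m)) with liftWalk-member c cs z rest ps m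
... | inj₁ (c' , c'∈ , e) = inj₁ (c' , there c'∈ , e)
... | inj₂ (u , v , q' , e , pu , inj₁ (refl , _)) = inj₂ (u , v , q' , e , pu , inj₂ (here refl))
... | inj₂ (u , v , q' , e , pu , inj₂ u∈) = inj₂ (u , v , q' , e , pu , inj₂ (there u∈))

-- The lifted walk repeats no cell, provided the walk a , b₁ , … , bₖ
-- repeats no vertex, z is not an inner vertex, and a closed walk (a ≡ z)
-- has at least two inner vertices (so it does not run back along one edge).
liftWalk-unique : ∀ a bs z (lk : Linked Adj (a ∷ bs ++ [ z ])) → All Positive (a ∷ bs ++ [ z ]) →
  Unique (a ∷ bs) → z ∉ bs → (a ≡ z → 2 ≤ length bs) → Unique (liftWalk a bs z lk)
liftWalk-unique a [] z (q ∷ [-]) _ _ _ _ = [] ∷ []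
liftWalk-unique a (b ∷ bs) z (q ∷ rest) (pa ∷ pb ∷ ps) (a∉ ∷ b∉ ∷ u) z∉ closed⇒long =
  (midpoint≢expand q pb ∷ midpoint-fresh) ∷ b-fresh
  ∷ liftWalk-unique b bs z rest (pb ∷ ps) (b∉ ∷ u) (λ m → z∉ (there m)) (λ b≡z → ⊥-elim (z∉ (here (sym b≡z))))
  where
  inner-positive : ∀ {c} → c ∈ bs → Positive c
  inner-positive m = All.lookup ps (∈-++⁺ˡ m)
  -- a walk that returns to a at its second step would be a ≡ next bs z
  no-immediate-return : ∀ bs' → (a ≡ z → 2 ≤ length (b ∷ bs')) → All (a ≢_) (b ∷ bs') → a ≢ next bs' z
  no-immediate-return [] short _ a≡z with short a≡z
  ... | s≤s ()
  no-immediate-return (c ∷ _) _ (_ ∷ a≢c ∷ _) = a≢c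
  midpoint-fresh : All (midpoint q ≢_) (liftWalk b bs z rest)
  midpoint-fresh = All.tabulate λ m → fresh (liftWalk-member b bs z rest (pb ∷ ps) m)
    where
    fresh : ∀ {w} → LiftedCell w b bs z → midpoint q ≢ w
    fresh (inj₁ (c , c∈ , refl)) = midpoint≢expand q (inner-positive c∈)
    fresh (inj₂ (u , v , q' , refl , pu , where-u)) e with midpoint-injective q q' pa pu e | where-u
    ... | inj₁ (refl , _) | inj₁ (refl , _) = All.lookup a∉ (here refl) refl
    ... | inj₁ (refl , _) | inj₂ u∈ = All.lookup a∉ (there u∈) refl
    ... | inj₂ (refl , refl) | inj₂ u∈ = All.lookup b∉ u∈ refl
    ... | inj₂ (refl , refl) | inj₁ (_ , a≡next) = no-immediate-return bs closed⇒long a∉ a≡next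
  b-fresh : All (expandCell b ≢_) (liftWalk b bs z rest)
  b-fresh = All.tabulate λ m → fresh (liftWalk-member b bs z rest (pb ∷ ps) m)
    where
    fresh : ∀ {w} → LiftedCell w b bs z → expandCell b ≢ w
    fresh (inj₁ (c , c∈ , refl)) e = All.lookup b∉ c∈ (expandCell-injective e)
    fresh (inj₂ (_ , _ , q' , refl , _)) e = midpoint≢expand q' pb (sym e)

module OneEmptyCorner (m : ℕ) (m≥1 : 1 ≤ m) (A : Arr (suc (2 * m)))
  (compressible : Compressible (suc (2 * m)) A)
  (r₀ c₀ : ℕ) (κ-corner : corner (suc (2 * m)) r₀ c₀ ≡ true) (κ-empty : at A r₀ c₀ ≡ false)
  (κ-only : ∀ r c → corner (suc (2 * m)) r c ≡ true → at A r c ≡ false → r ≡ r₀ × c ≡ c₀) where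

  N : ℕ
  N = suc (2 * m)

  N≥2 : 2 ≤ N
  N≥2 = s≤s (≤-trans m≥1 (m≤m+n m (m + 0)))

  boundary-filled : ∀ r c → inSq N r c ≡ true → nonCornerBoundary N r c ≡ true → at A r c ≡ true
  boundary-filled = proj₁ compressible

  odd-sum-filled : ∀ r c → interior N r c ≡ true → (r + c) % 2 ≡ 1 → at A r c ≡ true
  odd-sum-filled = proj₁ (proj₂ (proj₂ compressible))

  even-even-empty : ∀ r c → interior N r c ≡ true → r % 2 ≡ 0 → c % 2 ≡ 0 → at A r c ≡ false
  even-even-empty = proj₂ (proj₂ (proj₂ compressible))

  κ-isCorner : IsCorner N (r₀ , c₀)
  κ-isCorner = isB-elim N r₀ (proj₁ (corner-elim N r₀ c₀ κ-corner))
             , isB-elim N c₀ (proj₂ (corner-elim N r₀ c₀ κ-corner))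

  -- a cell of the square off the corners with odd coordinate sum is a tile
  -- (on the boundary because boundary cells are tiles, inside by P_N)
  odd-sum-tile : ∀ r c → InSq N (r , c) → (isB N r ≡ false ⊎ isB N c ≡ false) → (r + c) % 2 ≡ 1 → at A r c ≡ true
  odd-sum-tile r c x∈ off-corner odd with isB N r in er | isB N c in ec
  ... | false | false = odd-sum-filled r c (interior-intro N r c (inSq-intro N r c x∈) er ec) odd
  ... | true | false = boundary-filled r c (inSq-intro N r c x∈) (nonCornerBoundary-row N r c er ec)
  ... | false | true = boundary-filled r c (inSq-intro N r c x∈) (nonCornerBoundary-col N r c er ec)
  ... | true | true with off-corner
  ... | inj₁ ()
  ... | inj₂ ()

  N-odd : N % 2 ≡ 1
  N-odd = subst (λ n → suc n % 2 ≡ 1) (double≡2* m) (suc-double-odd m)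

  -- N is odd, so an even coordinate is never 1 or N
  even⇒not-boundary : ∀ n → n % 2 ≡ 0 → isB N n ≡ false
  even⇒not-boundary n even = isB-false N n
    (λ n≡1 → odd≢even {n} (cong (_% 2) n≡1) even) (λ n≡N → odd≢even {n} (trans (cong (_% 2) n≡N) N-odd) even)

  even-even⇒empty : ∀ x → EvenEven x → atc A x ≡ false
  even-even⇒empty (r , c) (er , ec) with inSq? N (r , c)
  ... | no x∉ = outside⇒empty A (r , c) x∉
  ... | yes x∈ = even-even-empty r c
        (interior-intro N r c (inSq-intro N r c x∈) (even⇒not-boundary r er) (even⇒not-boundary c ec)) er ec

  -- an empty cell of the square other than κ is interior (boundary cells
  -- other than corners are tiles, κ is the only empty corner) and has even
  -- coordinate sum (interior cells with odd sum are tiles)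
  empty-interior-even : ∀ r c → InSq N (r , c) → (r , c) ≢ (r₀ , c₀) → at A r c ≡ false →
    isB N r ≡ false × isB N c ≡ false × (r + c) % 2 ≡ 0
  empty-interior-even r c x∈ x≢κ empty with isB N r in er | isB N c in ec
  ... | true | true = ⊥-elim (x≢κ (uncurry (cong₂ _,_) (κ-only r c (corner-intro N r c er ec) empty)))
  ... | true | false =
    ⊥-elim (tile≢empty (boundary-filled r c (inSq-intro N r c x∈) (nonCornerBoundary-row N r c er ec)) empty)
  ... | false | true =
    ⊥-elim (tile≢empty (boundary-filled r c (inSq-intro N r c x∈) (nonCornerBoundary-col N r c er ec)) empty)
  ... | false | false with mod2-cases (r + c)
  ... | inj₂ odd = ⊥-elim (tile≢empty (odd-sum-filled r c (interior-intro N r c (inSq-intro N r c x∈) er ec) odd) empty)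
  ... | inj₁ even = refl , refl , even

  -- the neighbours of an interior cell with even coordinate sum have odd
  -- sum and are not corners, hence are tiles
  even-interior-neighbour : ∀ {r c y} → Adj (r , c) y → InSq N (r , c) →
    isB N r ≡ false → isB N c ≡ false → (r + c) % 2 ≡ 0 → atc A y ≡ true
  even-interior-neighbour {r} {c} down (1≤r , r≤N , 1≤c , c≤N) er ec even =
    odd-sum-tile (suc r) c (s≤s z≤n , ≤∧≢⇒< r≤N (isB-false⇒≢K N r er) , 1≤c , c≤N) (inj₂ ec)
      (even⇒suc-odd (r + c) even)
  even-interior-neighbour {suc zero} {c} up _ er ec even = ⊥-elim (isB-false⇒≢1 N 1 er refl)
  even-interior-neighbour {suc (suc r)} {c} up (_ , r≤N , 1≤c , c≤N) er ec even =
    odd-sum-tile (suc r) c (s≤s z≤n , ≤-trans (n≤1+n _) r≤N , 1≤c , c≤N) (inj₂ ec)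
      (suc-even⇒odd (suc r + c) even)
  even-interior-neighbour {r} {c} right (1≤r , r≤N , 1≤c , c≤N) er ec even =
    odd-sum-tile r (suc c) (1≤r , r≤N , s≤s z≤n , ≤∧≢⇒< c≤N (isB-false⇒≢K N c ec)) (inj₁ er)
      (subst (λ z → z % 2 ≡ 1) (sym (+-suc r c)) (even⇒suc-odd (r + c) even))
  even-interior-neighbour {r} {suc zero} left _ er ec even = ⊥-elim (isB-false⇒≢1 N 1 ec refl)
  even-interior-neighbour {r} {suc (suc c)} left (1≤r , r≤N , _ , c≤N) er ec even =
    odd-sum-tile r (suc c) (1≤r , r≤N , s≤s z≤n , ≤-trans (n≤1+n _) c≤N) (inj₁ er)
      (suc-even⇒odd (r + suc c) (subst (λ z → z % 2 ≡ 0) (+-suc r (suc c)) even))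

  A-empties-isolated : EmptiesIsolated A (r₀ , c₀)
  A-empties-isolated (r , c) y x∈ x≢κ empty x→y =
    let (er , ec , even) = empty-interior-even r c x∈ x≢κ empty in even-interior-neighbour x→y x∈ er ec even

  A-efficient : Acyclic A → EffStruct A
  A-efficient = SingleEmptyCorner.efficient A N≥2 r₀ c₀ κ-isCorner κ-empty A-empties-isolated

  M : ℕ
  M = suc m

  M≥2 : 2 ≤ M
  M≥2 = s≤s m≥1

  C : Arr M
  C = compress m A

  expand-M : expand M ≡ N
  expand-M = cong suc (double≡2* m)

  ≡ᵇ-double : ∀ a b → (double a ≡ᵇ double b) ≡ (a ≡ᵇ b)
  ≡ᵇ-double zero zero = refl
  ≡ᵇ-double zero (suc b) = refl
  ≡ᵇ-double (suc a) zero = refl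
  ≡ᵇ-double (suc a) (suc b) = ≡ᵇ-double a b

  isB-expand : ∀ a → isB M (suc a) ≡ isB N (suc (double a))
  isB-expand a = cong₂ _∨_ (first-row a)
    (trans (sym (≡ᵇ-double a m)) (cong (double a ≡ᵇ_) (double≡2* m)))
    where
    first-row : ∀ a → (a ≡ᵇ 0) ≡ (double a ≡ᵇ 0)
    first-row zero = refl
    first-row (suc a) = refl

  double≤2m : ∀ {a} → a ≤ m → double a ≤ 2 * m
  double≤2m a≤m = subst (_ ≤_) (double≡2* m) (double-mono a≤m)

  expand-inSq : ∀ x → InSq M x → InSq N (expandCell x)
  expand-inSq (suc a , suc b) (_ , a<M , _ , b<M) =
    s≤s z≤n , s≤s (double≤2m (≤-pred a<M)) , s≤s z≤n , s≤s (double≤2m (≤-pred b<M))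

  contract-≤ : ∀ {a} → suc (double a) ≤ N → suc a ≤ M
  contract-≤ le = s≤s (double-cancel-≤ (subst (_ ≤_) (sym (double≡2* m)) (≤-pred le)))

  inSq⇒positive : ∀ {K} x → InSq K x → Positive x
  inSq⇒positive (suc a , suc b) _ = a , b , refl

  compressValue : ℕ → ℕ → Bool
  compressValue a b = if nonCornerBoundary M (suc a) (suc b) then true else at A (suc (2 * a)) (suc (2 * b))

  -- the non-corner boundary cells of C are those of A, which are tiles
  compressValue-in-range : ∀ a b → a ≤ m → b ≤ m → compressValue a b ≡ at A (suc (double a)) (suc (double b))
  compressValue-in-range a b a≤m b≤m with nonCornerBoundary M (suc a) (suc b) in e
  ... | false = cong₂ (λ p q → at A (suc p) (suc q)) (sym (double≡2* a)) (sym (double≡2* b))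
  ... | true = sym (boundary-filled (suc (double a)) (suc (double b))
                     (inSq-intro N _ _ (expand-inSq (suc a , suc b) (s≤s z≤n , s≤s a≤m , s≤s z≤n , s≤s b≤m)))
                     (trans (sym (cong₂ (λ p q → (p ∨ q) ∧ not (p ∧ q)) (isB-expand a) (isB-expand b))) e))

  at-suc : ∀ {K} (B : Arr K) r c (i j : Fin K) → toFin? K r ≡ just i → toFin? K c ≡ just j →
    at B (suc r) (suc c) ≡ B i j
  at-suc {K} B r c i j e₁ e₂ rewrite e₁ | e₂ = refl

  compress-at : ∀ x → atc C x ≡ atc A (expandCell x)
  compress-at (zero , c) = refl
  compress-at (suc a , zero) = refl
  compress-at (suc a , suc b) with a ≤? m | b ≤? m
  ... | yes a≤m | yes b≤m with toFin?-lt M a (s≤s a≤m) | toFin?-lt M b (s≤s b≤m)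
  ...   | i , e₁ | j , e₂ = begin
      at C (suc a) (suc b)  ≡⟨ at-suc C a b i j e₁ e₂ ⟩
      compressValue (toℕ i) (toℕ j)
        ≡⟨ cong₂ compressValue (proj₁ (toFin?-just M a e₁)) (proj₁ (toFin?-just M b e₂)) ⟩
      compressValue a b  ≡⟨ compressValue-in-range a b a≤m b≤m ⟩
      at A (suc (double a)) (suc (double b)) ∎
    where open ≡-Reasoning
  compress-at (suc a , suc b) | no a≰m | _ =
    trans (outside⇒empty C (suc a , suc b) (λ x∈ → a≰m (≤-pred (proj₁ (proj₂ x∈)))))
          (sym (outside⇒empty A (suc (double a) , suc (double b))
                 (λ X∈ → a≰m (≤-pred (contract-≤ (proj₁ (proj₂ X∈)))))))
  compress-at (suc a , suc b) | yes _ | no b≰m =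
    trans (outside⇒empty C (suc a , suc b) (λ x∈ → b≰m (≤-pred (proj₂ (proj₂ (proj₂ x∈))))))
          (sym (outside⇒empty A (suc (double a) , suc (double b))
                 (λ X∈ → b≰m (≤-pred (contract-≤ (proj₂ (proj₂ (proj₂ X∈))))))))

  expand-tile : ∀ x → Filled C x → Filled A (expandCell x)
  expand-tile x f = trans (sym (compress-at x)) f

  κᶜ : Cell
  κᶜ = (⌈ r₀ /2⌉ , ⌈ c₀ /2⌉)

  boundary-odd : ∀ {r} → r ≡ 1 ⊎ r ≡ N → r % 2 ≡ 1
  boundary-odd (inj₁ refl) = refl
  boundary-odd (inj₂ refl) = N-odd

  contract-boundary : ∀ {r} → r ≡ 1 ⊎ r ≡ N → ⌈ r /2⌉ ≡ 1 ⊎ ⌈ r /2⌉ ≡ M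
  contract-boundary (inj₁ refl) = inj₁ refl
  contract-boundary (inj₂ refl) = inj₂ (expand-injective (trans (expand-⌈odd/2⌉ N N-odd) (sym expand-M)))

  expand-κᶜ : expandCell κᶜ ≡ (r₀ , c₀)
  expand-κᶜ = cong₂ _,_ (expand-⌈odd/2⌉ r₀ (boundary-odd (proj₁ κ-isCorner)))
                        (expand-⌈odd/2⌉ c₀ (boundary-odd (proj₂ κ-isCorner)))

  κᶜ-isCorner : IsCorner M κᶜ
  κᶜ-isCorner = contract-boundary (proj₁ κ-isCorner) , contract-boundary (proj₂ κ-isCorner)

  κᶜ-empty : atc C κᶜ ≡ false
  κᶜ-empty = trans (compress-at κᶜ) (trans (cong (atc A) expand-κᶜ) κ-empty)

  module _ (A-acyclic : Acyclic A) where

    A-connected : ∀ x y → Filled A x → Filled A y → Path (Filled A) x y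
    A-connected = proj₂ (proj₁ A-acyclic)

    isolated-tile-only : ∀ z t → Filled A z → Filled A t → (∀ w → Adj z w → atc A w ≡ false) → t ≡ z
    isolated-tile-only z t fz ft isolated with A-connected z t fz ft
    ... | here _ = refl
    ... | step _ z→w rest = ⊥-elim (tile≢empty (path-head rest) (isolated _ z→w))

    -- but A has two tiles on its boundary, (1 , 2) and (2 , 1)
    no-isolated-tile : ∀ z → Filled A z → ¬ (∀ w → Adj z w → atc A w ≡ false)
    no-isolated-tile z fz isolated = distinct
      (trans (isolated-tile-only z (1 , 2) fz tile₁₂ isolated) (sym (isolated-tile-only z (2 , 1) fz tile₂₁ isolated)))
      where
      distinct : (1 , 2) ≢ (2 , 1)
      distinct ()
      2≢N : 2 ≢ N
      2≢N 2≡N = double≢odd m 0 (trans (double≡2* m) (sym (suc-injective 2≡N)))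
      tile₁₂ : Filled A (1 , 2)
      tile₁₂ = boundary-filled 1 2 (inSq-intro N 1 2 (s≤s z≤n , ≤-trans (s≤s z≤n) N≥2 , s≤s z≤n , N≥2))
                 (nonCornerBoundary-row N 1 2 (isB-intro N 1 (inj₁ refl)) (isB-false N 2 (λ ()) 2≢N))
      tile₂₁ : Filled A (2 , 1)
      tile₂₁ = boundary-filled 2 1 (inSq-intro N 2 1 (s≤s z≤n , N≥2 , s≤s z≤n , ≤-trans (s≤s z≤n) N≥2))
                 (nonCornerBoundary-col N 2 1 (isB-false N 2 (λ ()) 2≢N) (isB-intro N 1 (inj₁ refl)))

    -- The hypothesis of the criterion for C: if an empty cell x ≠ κᶜ of C had
    -- an empty neighbour y, the tile of A between their expansions (a tile as
    -- neighbour of the empty cell expandCell x) would be isolated.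
    C-empties-isolated : EmptiesIsolated C κᶜ
    C-empties-isolated x y x∈ x≢κᶜ x-empty x→y with atc C y in y-status
    ... | true = refl
    ... | false = ⊥-elim (no-isolated-tile mid mid-tile mid-isolated)
      where
      px : Positive x
      px = inSq⇒positive x x∈
      mid : Cell
      mid = midpoint x→y
      X-empty : atc A (expandCell x) ≡ false
      X-empty = trans (sym (compress-at x)) x-empty
      X≢κ : expandCell x ≢ (r₀ , c₀)
      X≢κ e = x≢κᶜ (expandCell-injective (trans e (sym expand-κᶜ)))
      mid-tile : atc A mid ≡ true
      mid-tile = A-empties-isolated (expandCell x) mid (expand-inSq x x∈) X≢κ X-empty (midpoint-adjˡ x→y px)
      mid-isolated : ∀ w → Adj mid w → atc A w ≡ false
      mid-isolated w mid→w with midpoint-neighbours x→y px mid→w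
      ... | inj₁ refl = X-empty
      ... | inj₂ (inj₁ refl) = trans (sym (compress-at y)) y-status
      ... | inj₂ (inj₂ even-even) = even-even⇒empty w even-even

    -- Invariant: the current cell w is expandCell x or
    -- one of its neighbours, i.e. a midpoint of an edge leaving x.
    project-path : ∀ {x z w} → Positive x → Filled C x → (w ≡ expandCell x ⊎ Adj (expandCell x) w) →
      Path (Filled A) w (expandCell z) → Positive z → Path (Filled C) x z
    project-path {x} px fx (inj₁ Z≡X) (here _) _ = subst (Path (Filled C) x) (expandCell-injective (sym Z≡X)) (here fx)
    project-path px fx (inj₂ X→Z) (here _) pz with neighbour-is-midpoint px X→Z
    ... | _ , q , Z≡mid = ⊥-elim (midpoint≢expand q pz (sym Z≡mid))
    project-path px fx (inj₁ refl) (step _ X→w rest) pz = project-path px fx (inj₂ X→w) rest pz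
    project-path px fx (inj₂ X→w) (step {y = w'} _ w→w' rest) pz with neighbour-is-midpoint px X→w
    ... | y , q , refl with midpoint-neighbours q px w→w'
    ...   | inj₁ refl = project-path px fx (inj₁ refl) rest pz
    ...   | inj₂ (inj₁ refl) = step fx q (project-path py fy (inj₁ refl) rest pz)
      where
      fy : Filled C y
      fy = trans (compress-at y) (path-head rest)
      py : Positive y
      py = inSq⇒positive y (filled⇒inSq C _ _ fy)
    ...   | inj₂ (inj₂ even-even) =
      ⊥-elim (tile≢empty (path-head rest) (even-even⇒empty w' even-even))

    -- C has a tile: its corners (1 , 1) and (1 , M) are corners of A, not both empty
    C-nonempty : ∃[ x ] Filled C x
    C-nonempty with at C 1 1 in e₁ | at C 1 M in e₂
    ... | true | _ = (1 , 1) , e₁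
    ... | false | true = (1 , M) , e₂
    ... | false | false = ⊥-elim (<⇒≢ m≥1 (sym (double-injective (suc-injective (trans c≡c₀ (sym 1≡c₀))))))
      where
      1≡c₀ : 1 ≡ c₀
      1≡c₀ = proj₂ (κ-only 1 1 refl (trans (sym (compress-at (1 , 1))) e₁))
      c≡c₀ : suc (double m) ≡ c₀
      c≡c₀ = proj₂ (κ-only 1 (suc (double m))
        (corner-intro N 1 (suc (double m)) refl (isB-intro N (suc (double m)) (inj₂ (cong suc (double≡2* m)))))
        (trans (sym (compress-at (1 , M))) e₂))

    C-connected : Polyomino C
    C-connected = C-nonempty , paths
      where
      paths : ∀ x z → Filled C x → Filled C z → Path (Filled C) x z
      paths x z fx fz = project-path (positive fx) fx (inj₁ refl)
        (A-connected (expandCell x) (expandCell z) (expand-tile x fx) (expand-tile z fz)) (positive fz)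
        where
        positive : ∀ {y} → Filled C y → Positive y
        positive {y} f = inSq⇒positive y (filled⇒inSq C _ _ f)

    -- The midpoint of an edge of the compressed square is a tile of A: it lies
    -- in the square, has odd coordinate sum and its even coordinate is not 1 or N.
    vertical-midpoint-tile : ∀ r c → 1 ≤ r → r ≤ m → 1 ≤ c → c ≤ M → at A (double r) (expand c) ≡ true
    vertical-midpoint-tile (suc a) (suc b) _ r≤m _ (s≤s b≤m) =
      odd-sum-tile (double (suc a)) (suc (double b))
        (s≤s z≤n , ≤-trans (double≤2m r≤m) (n≤1+n _) , s≤s z≤n , s≤s (double≤2m b≤m))
        (inj₁ (even⇒not-boundary (double (suc a)) (double-even (suc a))))
        (trans (double+-parity (suc a) (suc (double b))) (suc-double-odd b))

    horizontal-midpoint-tile : ∀ r c → 1 ≤ r → r ≤ M → 1 ≤ c → c ≤ m → at A (expand r) (double c) ≡ true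
    horizontal-midpoint-tile (suc a) (suc b) _ (s≤s a≤m) _ c≤m =
      odd-sum-tile (suc (double a)) (double (suc b))
        (s≤s z≤n , s≤s (double≤2m a≤m) , s≤s z≤n , ≤-trans (double≤2m c≤m) (n≤1+n _))
        (inj₂ (even⇒not-boundary (double (suc b)) (double-even (suc b))))
        (subst (λ z → z % 2 ≡ 1) (+-comm (double (suc b)) (suc (double a)))
               (trans (double+-parity (suc b) (suc (double a))) (suc-double-odd a)))

    midpoint-tile : ∀ {u v} (q : Adj u v) → InSq M u → InSq M v → Filled A (midpoint q)
    midpoint-tile (down {r} {c}) (1≤r , _ , 1≤c , c≤M) (_ , r<M , _ , _) =
      vertical-midpoint-tile r c 1≤r (≤-pred r<M) 1≤c c≤M
    midpoint-tile (up {r} {c}) (_ , r<M , 1≤c , c≤M) (1≤r , _ , _ , _) =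
      vertical-midpoint-tile r c 1≤r (≤-pred r<M) 1≤c c≤M
    midpoint-tile (right {r} {c}) (1≤r , r≤M , 1≤c , _) (_ , _ , _ , c<M) =
      horizontal-midpoint-tile r c 1≤r r≤M 1≤c (≤-pred c<M)
    midpoint-tile (left {r} {c}) (1≤r , r≤M , _ , c<M) (_ , _ , 1≤c , _) =
      horizontal-midpoint-tile r c 1≤r r≤M 1≤c (≤-pred c<M)

    C-tile-inSq : ∀ {x} → Filled C x → InSq M x
    C-tile-inSq {x} f = filled⇒inSq C (proj₁ x) (proj₂ x) f

    liftWalk-tiles : ∀ a bs z (lk : Linked Adj (a ∷ bs ++ [ z ])) → All (Filled C) (a ∷ bs ++ [ z ]) →
      All (Filled A) (liftWalk a bs z lk)
    liftWalk-tiles a [] z (q ∷ [-]) (fa ∷ fz ∷ []) = midpoint-tile q (C-tile-inSq fa) (C-tile-inSq fz) ∷ []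
    liftWalk-tiles a (b ∷ bs) z (q ∷ rest) (fa ∷ fb ∷ fs) =
      midpoint-tile q (C-tile-inSq fa) (C-tile-inSq fb) ∷ expand-tile b fb ∷ liftWalk-tiles b bs z rest (fb ∷ fs)

    lift-cycle : DualCycle C → DualCycle A
    lift-cycle (x , [] , () , _)
    lift-cycle (x , b ∷ bs , long , unique@(x∉ ∷ _) , tiles@(fx ∷ _) , linked) =
      expandCell x , liftWalk x (b ∷ bs) x linked , liftWalk-length x b bs x linked
      , head-fresh ∷ liftWalk-unique x (b ∷ bs) x linked positive unique x∉xs (λ _ → long)
      , expand-tile x fx ∷ liftWalk-tiles x (b ∷ bs) x linked closed-tiles
      , liftWalk-linked x (b ∷ bs) x linked positive
      where
      closed-tiles : All (Filled C) (x ∷ (b ∷ bs) ++ [ x ])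
      closed-tiles = Allₚ.++⁺ tiles (fx ∷ [])
      positive : All Positive (x ∷ (b ∷ bs) ++ [ x ])
      positive = All.map (λ {y} f → inSq⇒positive y (C-tile-inSq f)) closed-tiles
      x∉xs : x ∉ b ∷ bs
      x∉xs m = All.lookup x∉ m refl
      head-fresh : All (expandCell x ≢_) (liftWalk x (b ∷ bs) x linked)
      head-fresh = All.tabulate λ m → fresh (liftWalk-member x (b ∷ bs) x linked positive m)
        where
        fresh : ∀ {w} → LiftedCell w x (b ∷ bs) x → expandCell x ≢ w
        fresh (inj₁ (c , c∈ , refl)) e = x∉xs (subst (_∈ b ∷ bs) (sym (expandCell-injective e)) c∈)
        fresh (inj₂ (_ , _ , q , refl , _)) e = midpoint≢expand q (All.lookup positive (here refl)) (sym e)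

    C-acyclic : Acyclic C
    C-acyclic = C-connected , λ cycle → proj₂ A-acyclic (lift-cycle cycle)

    C-efficient : EffStruct C
    C-efficient =
      SingleEmptyCorner.efficient C M≥2 ⌈ r₀ /2⌉ ⌈ c₀ /2⌉ κᶜ-isCorner κᶜ-empty C-empties-isolated C-acyclic

mainTheorem16 : (m : ℕ) → 1 ≤ m → (A : Arr (suc (2 * m))) →
    Compressible (suc (2 * m)) A → ExactlyOneEmptyCorner (suc (2 * m)) A →
    Acyclic A → (EffStruct A ⇔ EffStruct (compress m A))
mainTheorem16 m m≥1 A compressible (r₀ , c₀ , κ-corner , κ-empty , κ-only) A-acyclic =
  mk⇔ (λ _ → C-efficient A-acyclic) (λ _ → A-efficient A-acyclic)
  where open OneEmptyCorner m m≥1 A compressible r₀ c₀ κ-corner κ-empty κ-only
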